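{- Let $n$ be an odd perfect square which is divisible by $p^4$ for some prime $p\geq 7$. Then $C_{S(n)^*}=5$.
   Context: $\mathbb Z_n=\mathbb Z/n\mathbb Z$; $S(n)^*=\{x^2:x\in\mathbb Z_n\}\setminus\{0\}$. For $A\subseteq\mathbb Z_n$, a subsequence $T$ of a sequence $(x_1,\dots,x_k)$ in $\mathbb Z_n$, with nonempty index set $I$, is an $A$-weighted zero-sum subsequence if there exist $a_i\in A$ ($i\in I$) with $\sum_{i\in I}a_ix_i=0$. $C_{S(n)^*}$ is the least positive integer $k$ such that every sequence of length $k$ in $\mathbb Z_n$ has an $S(n)^*$-weighted zero-sum subsequence consisting of consecutive terms. -}

module Defs where

open import Data.Nat using (ℕ; zero; suc; _+_; _*_; _%_; NonZero; _≤_; _<_)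
open import Data.Nat.Primality using (Prime)
open import Data.Nat.Divisibility using (_∣_)
open import Data.Fin using (Fin; toℕ)
open import Data.List using (List; []; _∷_; _++_; length)
open import Data.Product using (∃; ∃-syntax; _×_; _,_)
open import Relation.Binary.PropositionalEquality using (_≡_; _≢_)
open import Relation.Nullary using (¬_)

-- ℤ_n is modelled as Fin n (residues 0..n-1), arithmetic via ℕ and _%_ n.

InS* : (n : ℕ) .{{_ : NonZero n}} → Fin n → Set
InS* n a = (toℕ a ≢ 0) × (∃[ x ] ((toℕ {n} x * toℕ x) % n ≡ toℕ a))

wsum : ∀ {n} → List (Fin n) → List (Fin n) → ℕ
wsum (a ∷ as) (x ∷ xs) = toℕ a * toℕ x + wsum as xs
wsum _ _ = 0

data AllS* (n : ℕ) .{{_ : NonZero n}} : List (Fin n) → Set where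
  []  : AllS* n []
  _∷_ : ∀ {a as} → InS* n a → AllS* n as → AllS* n (a ∷ as)

WeightedZeroSum : (n : ℕ) .{{_ : NonZero n}} → List (Fin n) → Set
WeightedZeroSum n ys =
  (ys ≢ []) × (∃[ as ] (length as ≡ length ys × AllS* n as × (wsum as ys % n ≡ 0)))

HasConsecutiveWZS : (n : ℕ) .{{_ : NonZero n}} → List (Fin n) → Set
HasConsecutiveWZS n xs =
  ∃[ pre ] ∃[ ys ] ∃[ suf ] (xs ≡ pre ++ ys ++ suf × WeightedZeroSum n ys)

Prop-C : (n : ℕ) .{{_ : NonZero n}} → ℕ → Set
Prop-C n k = (xs : List (Fin n)) → length xs ≡ k → HasConsecutiveWZS n xs

IsCS* : (n : ℕ) .{{_ : NonZero n}} → ℕ → Set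
IsCS* n c = (1 ≤ c) × Prop-C n c × ((k : ℕ) → 1 ≤ k → k < c → ¬ Prop-C n k)

-- Write n = m² = p⁴ k².  Upper bound: in a sequence of five terms either some term x has
-- p² ∣ x, and the weight (k p)² kills it; or at least three terms are units modulo p, or at
-- least three are exactly divisible by p.  Then a diagonal congruence Σ cᵢ uᵢ² ≡ 0 with three
-- unit coefficients has a solution in units modulo p (pigeonhole, and a rational point on the
-- conic a X² + b Y² = a to make both coordinates units, which uses p ∤ 2 · 3 · 5), Hensel's
-- lemma lifts it modulo p² resp. p³, and the weights (k p uᵢ)² resp. (k uᵢ)², (k p uᵢ)² make
-- the whole sequence a zero-sum.  Lower bound: there are r, R for which m² ∣ x² + r y² + R z²
-- + r R w² forces m to divide x, y, z and w, so no subsequence of (1, r, R, r R) has a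
-- zero-sum whose weights are nonzero squares modulo n = m².

module Submission where

open import Defs
open import Data.Nat as ℕ using (ℕ; NonZero)
import Data.Nat.Divisibility as ℕ
open import Data.Nat.Primality using (Prime)
open import Relation.Binary.PropositionalEquality using (_≡_)
open import Relation.Nullary using (¬_)

module Divisibility where

  open import Data.Nat as ℕ using (ℕ; NonZero)
  import Data.Nat.Properties as ℕ
  open import Data.Nat.Primality using (Prime; ¬prime[1]; euclidsLemma; prime⇒irreducible; prime⇒nonZero)
  import Data.Nat.Divisibility as ℕ
  import Data.Nat.Tactic.RingSolver as ℕ-Solver
  open import Data.Nat.GCD using (module Bézout)
  open import Data.Nat.Coprimality using (Coprime; coprime-Bézout)
  open import Data.Integer hiding (NonZero)
  open import Data.Integer.Properties
  open import Data.Integer.Divisibility.Signed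
  open import Data.Integer.Tactic.RingSolver
  open import Data.Integer.DivMod using (_%ℕ_; _/ℕ_; a≡a%ℕn+[a/ℕn]*n)
  open import Data.Sum using (_⊎_; inj₁; inj₂; [_,_]′)
  open import Data.Product using (∃; _,_)
  open import Data.List using (List; _∷_)
  open import Data.Empty using (⊥-elim)
  open import Relation.Binary.PropositionalEquality
  open import Relation.Nullary using (¬_)

  infix 4 _∣ᶻ_ _∤ᶻ_

  ∣∧<⇒≡0 : ∀ {p k} → p ℕ.∣ k → k ℕ.< p → k ≡ 0
  ∣∧<⇒≡0 {k = ℕ.zero}  _   _   = refl
  ∣∧<⇒≡0 {k = ℕ.suc _} p∣k k<p = ⊥-elim (ℕ.<⇒≱ k<p (ℕ.∣⇒≤ p∣k))

  odd⇒≡2h+1 : ∀ n → ¬ 2 ℕ.∣ n → ∃ λ h → n ≡ ℕ.suc (h ℕ.+ h)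
  odd⇒≡2h+1 ℕ.zero                2∤n = ⊥-elim (2∤n (ℕ.divides 0 refl))
  odd⇒≡2h+1 (ℕ.suc ℕ.zero)        _   = 0 , refl
  odd⇒≡2h+1 (ℕ.suc (ℕ.suc n)) 2∤n+2 with odd⇒≡2h+1 n (λ 2∣n → 2∤n+2 (ℕ.∣m∣n⇒∣m+n (ℕ.∣-refl {2}) 2∣n))
  ... | h , n≡2h+1 = ℕ.suc h , cong (λ z → ℕ.suc (ℕ.suc z)) (trans n≡2h+1 (sym (ℕ.+-suc h h)))

  prime∣prime⇒≡ : ∀ {ℓ q} → Prime ℓ → Prime q → ℓ ℕ.∣ q → ℓ ≡ q
  prime∣prime⇒≡ pℓ pq ℓ∣q with prime⇒irreducible pq ℓ∣q
  ... | inj₁ ℓ≡1 = ⊥-elim (¬prime[1] (subst Prime ℓ≡1 pℓ))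
  ... | inj₂ ℓ≡q = ℓ≡q

  prime∤⇒coprime : ∀ {p a} → Prime p → ¬ p ℕ.∣ a → Coprime a p
  prime∤⇒coprime pr p∤a (d∣a , d∣p) with prime⇒irreducible pr d∣p
  ... | inj₁ d≡1 = d≡1
  ... | inj₂ refl = ⊥-elim (p∤a d∣a)

  p∣m²⇒p∣m : ∀ {p m} → Prime p → p ℕ.∣ m ℕ.* m → p ℕ.∣ m
  p∣m²⇒p∣m {m = m} pr p∣m² with euclidsLemma m m pr p∣m²
  ... | inj₁ p∣m = p∣m
  ... | inj₂ p∣m = p∣m

  p⁴∣m²⇒p²∣m : ∀ {p m} → Prime p → p ℕ.^ 4 ℕ.∣ m ℕ.* m → p ℕ.* p ℕ.∣ m
  p⁴∣m²⇒p²∣m {p} {m} pr p⁴∣m² with p∣m²⇒p∣m {m = m} pr (ℕ.∣-trans (ℕ.m∣m*n (p ℕ.^ 3)) p⁴∣m²)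
  ... | ℕ.divides m₁ refl = ℕ.*-monoˡ-∣ p (p∣m²⇒p∣m {m = m₁} pr (ℕ.∣-trans (ℕ.m∣m*n p)
          (ℕ.*-cancelˡ-∣ (p ℕ.* p) ⦃ ℕ.m*n≢0 p p ⦄ (subst₂ ℕ._∣_ (regroup₄ p) (regroup₂ m₁ p) p⁴∣m²))))
    where
    instance _ = prime⇒nonZero pr
    regroup₄ : ∀ p → p ℕ.* (p ℕ.* (p ℕ.* (p ℕ.* 1))) ≡ p ℕ.* p ℕ.* (p ℕ.* p)
    regroup₄ = ℕ-Solver.solve-∀
    regroup₂ : ∀ m p → m ℕ.* p ℕ.* (m ℕ.* p) ≡ p ℕ.* p ℕ.* (m ℕ.* m)
    regroup₂ = ℕ-Solver.solve-∀

  _∣ᶻ_ : ℕ → ℤ → Set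
  d ∣ᶻ z = + d ∣ z

  _∤ᶻ_ : ℕ → ℤ → Set
  d ∤ᶻ z = ¬ d ∣ᶻ z

  ∣ᶻ-resp : ∀ {d a b} → d ∣ᶻ a → a ≡ b → d ∣ᶻ b
  ∣ᶻ-resp d eq = subst (_ ∣_) eq d

  euclidsLemmaᶻ : ∀ {p} → Prime p → ∀ a b → p ∣ᶻ a * b → p ∣ᶻ a ⊎ p ∣ᶻ b
  euclidsLemmaᶻ {p} pr a b d
    with euclidsLemma ∣ a ∣ ∣ b ∣ pr (subst (p ℕ.∣_) (abs-* a b) (∣⇒∣ᵤ d))
  ... | inj₁ x = inj₁ (∣ᵤ⇒∣ x)
  ... | inj₂ y = inj₂ (∣ᵤ⇒∣ y)

  ∤∧∤⇒∤* : ∀ {p} → Prime p → ∀ a b → p ∤ᶻ a → p ∤ᶻ b → p ∤ᶻ a * b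
  ∤∧∤⇒∤* pr a b p∤a p∤b p∣ab = [ p∤a , p∤b ]′ (euclidsLemmaᶻ pr a b p∣ab)

  0<∧<⇒∤ : ∀ {p c} → 0 ℕ.< c → c ℕ.< p → p ∤ᶻ + c
  0<∧<⇒∤ 0<c c<p p∣c = ℕ.<⇒≢ 0<c (sym (∣∧<⇒≡0 (∣⇒∣ᵤ p∣c) c<p))

  ∣z-z%ℕ : ∀ z p .{{_ : NonZero p}} → p ∣ᶻ z - + (z %ℕ p)
  ∣z-z%ℕ z p = divides (z /ℕ p) (begin
    z - + (z %ℕ p)                               ≡⟨ cong (_- + (z %ℕ p)) (a≡a%ℕn+[a/ℕn]*n z p) ⟩
    + (z %ℕ p) + (z /ℕ p) * + p - + (z %ℕ p)     ≡⟨ cancel (+ (z %ℕ p)) ((z /ℕ p) * + p) ⟩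
    (z /ℕ p) * + p                               ∎)
    where
    open ≡-Reasoning
    cancel : ∀ r x → r + x - r ≡ x
    cancel = solve-∀

  inverseℕ : ∀ {p a} → Prime p → ¬ p ℕ.∣ a → ∃ λ i → p ∣ᶻ + a * i - 1ℤ
  inverseℕ {p} {a} pr p∤a with coprime-Bézout (prime∤⇒coprime pr p∤a)
  ... | Bézout.+- x y eq = + x , divides (+ y) (begin
    + a * + x - 1ℤ               ≡⟨ cong (_- 1ℤ) (trans (*-comm (+ a) (+ x)) (sym (pos-* x a))) ⟩
    + (x ℕ.* a) - 1ℤ             ≡⟨ cong (λ w → + w - 1ℤ) (sym eq) ⟩
    + (1 ℕ.+ y ℕ.* p) - 1ℤ       ≡⟨ cong (_- 1ℤ) (trans (pos-+ 1 (y ℕ.* p)) (cong (λ w → 1ℤ + w) (pos-* y p))) ⟩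
    1ℤ + + y * + p - 1ℤ          ≡⟨ cancel (+ y * + p) ⟩
    + y * + p                    ∎)
    where
    open ≡-Reasoning
    cancel : ∀ b → 1ℤ + b - 1ℤ ≡ b
    cancel = solve-∀
  ... | Bézout.-+ x y eq = - + x , divides (- + y) (begin
    + a * - + x - 1ℤ             ≡⟨ rearrange (+ x) (+ a) ⟩
    - (1ℤ + + x * + a)           ≡⟨ cong -_ (trans (cong (λ w → 1ℤ + w) (sym (pos-* x a))) (sym (pos-+ 1 (x ℕ.* a)))) ⟩
    - + (1 ℕ.+ x ℕ.* a)          ≡⟨ cong (λ w → - + w) eq ⟩
    - + (y ℕ.* p)                ≡⟨ cong -_ (pos-* y p) ⟩
    - (+ y * + p)                ≡⟨ neg-distribˡ-* (+ y) (+ p) ⟩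
    - + y * + p                  ∎)
    where
    open ≡-Reasoning
    rearrange : ∀ b c → c * - b - 1ℤ ≡ - (1ℤ + b * c)
    rearrange = solve-∀

  inverse : ∀ {p} → Prime p → ∀ z → p ∤ᶻ z → ∃ λ i → p ∣ᶻ z * i - 1ℤ
  inverse {p} pr z p∤z with inverseℕ {a = z %ℕ p} pr p∤r
    where
    instance _ = prime⇒nonZero pr
    p∤r : ¬ p ℕ.∣ (z %ℕ p)
    p∤r p∣r = p∤z (∣ᶻ-resp (∣m∣n⇒∣m+n (∣z-z%ℕ z p) (∣ᵤ⇒∣ p∣r)) (cancel z (+ (z %ℕ p))))
      where cancel : ∀ a b → a - b + b ≡ a
            cancel = solve-∀
  ... | i , p∣ri-1 = i , ∣ᶻ-resp (∣m∣n⇒∣m+n (∣m⇒∣m*n i (∣z-z%ℕ z p)) p∣ri-1) (split z (+ (z %ℕ p)) i)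
    where
    instance _ = prime⇒nonZero pr
    split : ∀ a b c → (a - b) * c + (b * c - 1ℤ) ≡ a * c - 1ℤ
    split = solve-∀

  prime∤1 : ∀ {p} → Prime p → p ∤ᶻ 1ℤ
  prime∤1 pr p∣1 = ¬prime[1] (subst Prime (ℕ.∣1⇒≡1 (∣⇒∣ᵤ p∣1)) pr)

  inverse-∤ : ∀ {p} → Prime p → ∀ z i → p ∣ᶻ z * i - 1ℤ → p ∤ᶻ i
  inverse-∤ pr z i p∣zi-1 p∣i = prime∤1 pr (∣ᶻ-resp (∣m∣n⇒∣m-n (∣n⇒∣m*n z p∣i) p∣zi-1) (cancel z i))
    where
    cancel : ∀ z i → z * i - (z * i - 1ℤ) ≡ 1ℤ
    cancel = solve-∀

  %ℕ-≡⇒∣- : ∀ x y p .{{_ : NonZero p}} → x %ℕ p ≡ y %ℕ p → p ∣ᶻ x - y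
  %ℕ-≡⇒∣- x y p eq = ∣ᶻ-resp (∣m∣n⇒∣m-n (∣z-z%ℕ x p) (∣z-z%ℕ y p))
    (trans (cong (λ r → x - + (x %ℕ p) - (y - + r)) (sym eq)) (cancel x y (+ (x %ℕ p))))
    where
    cancel : ∀ x y r → x - r - (y - r) ≡ x - y
    cancel = solve-∀

  ∣-∧<⇒≡ : ∀ {p a b} → a ℕ.< p → b ℕ.< p → p ∣ᶻ + a - + b → a ≡ b
  ∣-∧<⇒≡ {p} {a} {b} a<p b<p p∣a-b with ℕ.≤-total a b
  ... | inj₁ a≤b =
    ℕ.≤-antisym a≤b (ℕ.m∸n≡0⇒m≤n (∣∧<⇒≡0 (∣⇒∣ᵤ p∣b∸a) (ℕ.≤-<-trans (ℕ.m∸n≤m b a) b<p)))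
    where
    p∣b∸a : p ∣ᶻ + (b ℕ.∸ a)
    p∣b∸a = ∣ᶻ-resp (∣m⇒∣-m p∣a-b) (trans (neg-minus (+ a) (+ b)) (trans ([+m]-[+n]≡m⊖n b a) (⊖-≥ a≤b)))
      where neg-minus : ∀ a b → - (a - b) ≡ b - a
            neg-minus = solve-∀
  ... | inj₂ b≤a =
    ℕ.≤-antisym (ℕ.m∸n≡0⇒m≤n (∣∧<⇒≡0 (∣⇒∣ᵤ p∣a∸b) (ℕ.≤-<-trans (ℕ.m∸n≤m a b) a<p))) b≤a
    where
    p∣a∸b : p ∣ᶻ + (a ℕ.∸ b)
    p∣a∸b = ∣ᶻ-resp p∣a-b (trans ([+m]-[+n]≡m⊖n a b) (⊖-≥ b≤a))

  diagonal : List ℤ → List ℤ → ℤ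
  diagonal (c ∷ cs) (u ∷ us) = c * (u * u) + diagonal cs us
  diagonal _        _        = 0ℤ

  Anisotropic : ℕ → ℕ → Set
  Anisotropic q r = ∀ x y → q ∣ᶻ x * x + + r * (y * y) → q ∣ᶻ y

  Anisotropic-resp : ∀ {q r r'} → q ∣ᶻ + r - + r' → Anisotropic q r' → Anisotropic q r
  Anisotropic-resp {q} {r} {r'} q∣r-r' aniso x y q∣x²+ry² =
    aniso x y (∣ᶻ-resp (∣m∣n⇒∣m-n q∣x²+ry² (∣m⇒∣m*n (y * y) q∣r-r')) (shift x y (+ r) (+ r')))
    where
    shift : ∀ x y r r' → x * x + r * (y * y) - (r - r') * (y * y) ≡ x * x + r' * (y * y)
    shift = solve-∀


module OddPrime (p h : ℕ) (pr : Prime p) (p≡2h+1 : p ≡ ℕ.suc (h ℕ.+ h)) where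

  open import Data.Nat as ℕ using (ℕ; zero; suc; NonZero)
  open import Data.Nat.Primality using (Prime; ¬prime[1]; prime⇒nonZero)
  import Data.Nat.Properties as ℕ
  import Data.Nat.Divisibility as ℕ
  open import Data.Integer hiding (NonZero; suc)
  open import Data.Integer.Properties
  open import Data.Integer.Divisibility.Signed
  open import Data.Integer.Tactic.RingSolver
  open import Data.Integer.DivMod using (_%ℕ_; n%ℕd<d)
  open import Data.Fin as Fin using (Fin; toℕ; fromℕ<; splitAt)
  import Data.Fin.Properties as Fin
  open import Data.Sum using (_⊎_; inj₁; inj₂; [_,_]′)
  open import Data.Product using (∃; ∃₂; _×_; _,_; proj₁; proj₂)
  open import Data.List using ([]; _∷_)
  open import Relation.Binary.PropositionalEquality
  open import Relation.Nullary using (¬_; Dec; yes; no)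
  open import Relation.Nullary.Decidable using (decidable-stable)
  open import Data.Empty using (⊥-elim)
  open Divisibility

  instance
    p-nonZero : NonZero p
    p-nonZero = prime⇒nonZero pr

  sq : ℕ → ℤ
  sq u = + u * + u

  h<p : h ℕ.< p
  h<p rewrite p≡2h+1 = ℕ.s≤s (ℕ.m≤m+n h h)

  1≤h : 1 ℕ.≤ h
  1≤h = half-positive h p≡2h+1
    where
    half-positive : ∀ k → p ≡ suc (k ℕ.+ k) → 1 ℕ.≤ k
    half-positive zero    p≡1 = ⊥-elim (¬prime[1] (subst Prime p≡1 pr))
    half-positive (suc _) _   = ℕ.s≤s ℕ.z≤n

  p∤2 : p ∤ᶻ + 2
  p∤2 = 0<∧<⇒∤ (ℕ.s≤s ℕ.z≤n) (subst (2 ℕ.<_) (sym p≡2h+1) (ℕ.s≤s (ℕ.+-mono-≤ 1≤h 1≤h)))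

  ≤h⇒∤ : ∀ u → u ≢ 0 → u ℕ.≤ h → p ∤ᶻ + u
  ≤h⇒∤ u u≢0 u≤h p∣u = u≢0 (∣∧<⇒≡0 (∣⇒∣ᵤ p∣u) (ℕ.≤-<-trans u≤h h<p))

  ∣sq-sq⇒≡ : ∀ u v → u ℕ.≤ h → v ℕ.≤ h → p ∣ᶻ sq u - sq v → u ≡ v
  ∣sq-sq⇒≡ u v u≤h v≤h p∣u²-v² with euclidsLemmaᶻ pr (+ u - + v) (+ u + + v) (∣ᶻ-resp p∣u²-v² (factor (+ u) (+ v)))
    where
    factor : ∀ a b → a * a - b * b ≡ (a - b) * (a + b)
    factor = solve-∀
  ... | inj₁ p∣u-v = ∣-∧<⇒≡ (ℕ.≤-<-trans u≤h h<p) (ℕ.≤-<-trans v≤h h<p) p∣u-v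
  ... | inj₂ p∣u+v = trans (ℕ.m+n≡0⇒m≡0 u u+v≡0) (sym (ℕ.m+n≡0⇒n≡0 u u+v≡0))
    where
    u+v<p : u ℕ.+ v ℕ.< p
    u+v<p = subst (u ℕ.+ v ℕ.<_) (sym p≡2h+1) (ℕ.s≤s (ℕ.+-mono-≤ u≤h v≤h))
    u+v≡0 : u ℕ.+ v ≡ 0
    u+v≡0 = ∣∧<⇒≡0 (∣⇒∣ᵤ (∣ᶻ-resp p∣u+v (sym (pos-+ u v)))) u+v<p

  private
    value : ℤ → ℤ → ℤ → Fin (suc h) ⊎ Fin (suc h) → ℤ
    value a b c (inj₁ u) = a * sq (toℕ u)
    value a b c (inj₂ v) = - (b * sq (toℕ v)) - c

    ≤h : (u : Fin (suc h)) → toℕ u ℕ.≤ h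
    ≤h u = ℕ.≤-pred (Fin.toℕ<n u)

    collision : ∀ a b c → p ∤ᶻ a → p ∤ᶻ b → ∀ x y → x ≢ y → p ∣ᶻ value a b c x - value a b c y →
      ∃₂ λ u v → u ℕ.≤ h × v ℕ.≤ h × p ∣ᶻ a * sq u + b * sq v + c
    collision a b c p∤a p∤b (inj₁ u) (inj₁ u') u≢u' p∣ =
      ⊥-elim ([ p∤a , (λ p∣sq-sq → u≢u' (cong inj₁ (Fin.toℕ-injective (∣sq-sq⇒≡ _ _ (≤h u) (≤h u') p∣sq-sq)))) ]′
                (euclidsLemmaᶻ pr a _ (∣ᶻ-resp p∣ (factor a _ _))))
      where factor : ∀ a x y → a * x - a * y ≡ a * (x - y)
            factor = solve-∀
    collision a b c p∤a p∤b (inj₂ v) (inj₂ v') v≢v' p∣ =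
      ⊥-elim ([ p∤b , (λ p∣sq-sq → v≢v' (cong inj₂ (Fin.toℕ-injective (sym (∣sq-sq⇒≡ _ _ (≤h v') (≤h v) p∣sq-sq))))) ]′
                (euclidsLemmaᶻ pr b _ (∣ᶻ-resp p∣ (factor b c _ _))))
      where factor : ∀ b c x y → - (b * x) - c - (- (b * y) - c) ≡ b * (y - x)
            factor = solve-∀
    collision a b c _ _ (inj₁ u) (inj₂ v) _ p∣ = toℕ u , toℕ v , ≤h u , ≤h v , ∣ᶻ-resp p∣ (rearrange a b c _ _)
      where rearrange : ∀ a b c x y → a * x - (- (b * y) - c) ≡ a * x + b * y + c
            rearrange = solve-∀
    collision a b c _ _ (inj₂ v) (inj₁ u) _ p∣ =
      toℕ u , toℕ v , ≤h u , ≤h v , ∣ᶻ-resp (∣m⇒∣-m p∣) (rearrange a b c _ _)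
      where rearrange : ∀ a b c x y → - (- (b * y) - c - a * x) ≡ a * x + b * y + c
            rearrange = solve-∀

    splitAt-injective : ∀ {i j} → splitAt (suc h) {suc h} i ≡ splitAt (suc h) j → i ≡ j
    splitAt-injective {i} {j} eq = trans (sym (Fin.join-splitAt (suc h) (suc h) i))
      (trans (cong (Fin.join (suc h) (suc h)) eq) (Fin.join-splitAt (suc h) (suc h) j))

    p<2h+2 : p ℕ.< suc h ℕ.+ suc h
    p<2h+2 rewrite p≡2h+1 = ℕ.s≤s (ℕ.≤-reflexive (sym (ℕ.+-suc h h)))

  -- Among the 2 h + 2 values a u² and - b v² - c two agree modulo p = 2 h + 1,
  -- and two values on the same side never do.
  diagonal₂-solvable : ∀ a b c → p ∤ᶻ a → p ∤ᶻ b →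
    ∃₂ λ u v → u ℕ.≤ h × v ℕ.≤ h × p ∣ᶻ a * sq u + b * sq v + c
  diagonal₂-solvable a b c p∤a p∤b
    with Fin.pigeonhole p<2h+2 (λ i → fromℕ< (n%ℕd<d (value a b c (splitAt (suc h) i)) p))
  ... | i , j , i<j , fi≡fj = collision a b c p∤a p∤b (splitAt (suc h) i) (splitAt (suc h) j)
        (λ eq → ℕ.<⇒≢ i<j (cong toℕ (splitAt-injective eq)))
        (%ℕ-≡⇒∣- (value a b c (splitAt (suc h) i)) (value a b c (splitAt (suc h) j)) p
            (trans (sym (Fin.toℕ-fromℕ< _)) (trans (cong toℕ fi≡fj) (Fin.toℕ-fromℕ< _))))

  square-≤h : ∀ x → ∃ λ u → u ℕ.≤ h × p ∣ᶻ x * x - sq u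
  square-≤h x with x %ℕ p ℕ.≤? h
  ... | yes r≤h = x %ℕ p , r≤h , ∣ᶻ-resp (∣m⇒∣m*n (x + + (x %ℕ p)) (∣z-z%ℕ x p)) (factor x (+ (x %ℕ p)))
    where factor : ∀ x r → (x - r) * (x + r) ≡ x * x - r * r
          factor = solve-∀
  ... | no r≰h = p ℕ.∸ r , p-r≤h ,
    ∣ᶻ-resp (∣m∣n⇒∣m+n (∣m⇒∣m*n (x + + r) (∣z-z%ℕ x p)) (∣n⇒∣m*n (+ 2 * + r - + p) ∣-refl))
            (rearrange x (+ r) (+ p) (+ (p ℕ.∸ r)) p-r≡)
    where
    r = x %ℕ p
    r<p : r ℕ.< p
    r<p = n%ℕd<d x p
    p-r≤h : p ℕ.∸ r ℕ.≤ h
    p-r≤h = ℕ.+-cancelʳ-≤ r (p ℕ.∸ r) h (ℕ.≤-trans (ℕ.≤-reflexive (ℕ.m∸n+n≡m (ℕ.<⇒≤ r<p)))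
      (subst (ℕ._≤ h ℕ.+ r) (sym p≡2h+1)
             (ℕ.≤-trans (ℕ.≤-reflexive (sym (ℕ.+-suc h h))) (ℕ.+-monoʳ-≤ h (ℕ.≰⇒> r≰h)))))
    p-r≡ : + (p ℕ.∸ r) ≡ + p - + r
    p-r≡ = trans (sym (⊖-≥ (ℕ.<⇒≤ r<p))) (sym ([+m]-[+n]≡m⊖n p r))
    rearrange : ∀ x r p u → u ≡ p - r → (x - r) * (x + r) + (+ 2 * r - p) * p ≡ x * x - u * u
    rearrange x r p u refl = solve (x ∷ r ∷ p ∷ [])

  private
    NegativeSquare : Fin (h ℕ.+ h) → Set
    NegativeSquare k = ∃ λ (u : Fin h) → p ∣ᶻ sq (suc (toℕ u)) + + suc (toℕ k)

    k+1<p : (k : Fin (h ℕ.+ h)) → suc (toℕ k) ℕ.< p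
    k+1<p k = subst (suc (toℕ k) ℕ.<_) (sym p≡2h+1) (ℕ.s≤s (Fin.toℕ<n k))

    h<2h : h ℕ.< h ℕ.+ h
    h<2h = ℕ.≤-trans (ℕ.≤-reflexive (ℕ.+-comm 1 h)) (ℕ.+-monoʳ-≤ h 1≤h)

    -- The h nonzero values u² modulo p cannot cover all 2 h nonzero residues.
    not-all-negative-squares : ¬ (∀ k → NegativeSquare k)
    not-all-negative-squares negSq with Fin.pigeonhole h<2h (λ k → proj₁ (negSq k))
    ... | i , j , i<j , ui≡uj = ℕ.<⇒≢ i<j (ℕ.suc-injective (∣-∧<⇒≡ (k+1<p i) (k+1<p j) p∣i-j))
      where
      p∣i-j : p ∣ᶻ + suc (toℕ i) - + suc (toℕ j)
      p∣i-j = ∣ᶻ-resp (∣m∣n⇒∣m-n (proj₂ (negSq i)) (proj₂ (negSq j)))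
        (trans (cong (λ u → sq (suc (toℕ (proj₁ (negSq i)))) + + suc (toℕ i) - (sq (suc (toℕ u)) + + suc (toℕ j)))
                     (sym ui≡uj))
               (cancel (sq (suc (toℕ (proj₁ (negSq i))))) (+ suc (toℕ i)) (+ suc (toℕ j))))
        where cancel : ∀ s a b → s + a - (s + b) ≡ a - b
              cancel = solve-∀

    negativeSquare? : ∀ k → Dec (NegativeSquare k)
    negativeSquare? k = Fin.any? λ u → + p ∣? (sq (suc (toℕ u)) + + suc (toℕ k))

    negativeSquare : ∀ k x → p ∣ᶻ x * x + + suc (toℕ k) → NegativeSquare k
    negativeSquare k x p∣x²+k+1 with square-≤h x
    ... | zero , _ , p∣x² = ⊥-elim (ℕ.0≢1+n (sym (∣∧<⇒≡0 (∣⇒∣ᵤ p∣k+1) (k+1<p k))))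
      where
      p∣k+1 : p ∣ᶻ + suc (toℕ k)
      p∣k+1 = ∣ᶻ-resp (∣m∣n⇒∣m-n p∣x²+k+1 p∣x²) (cancel x (+ suc (toℕ k)))
        where cancel : ∀ x n → x * x + n - (x * x - 0ℤ * 0ℤ) ≡ n
              cancel = solve-∀
    ... | suc u , u<h , p∣x²-u² = fromℕ< u<h , ∣ᶻ-resp (∣m∣n⇒∣m-n p∣x²+k+1 p∣x²-u²)
        (trans (cancel x (sq (suc u)) (+ suc (toℕ k))) (cong (λ v → sq (suc v) + + suc (toℕ k)) (sym (Fin.toℕ-fromℕ< u<h))))
      where cancel : ∀ x s n → x * x + n - (x * x - s) ≡ s + n
            cancel = solve-∀

  nonresidue : ∃ λ N → ∀ x → p ∤ᶻ x * x + + N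
  nonresidue = suc (toℕ k) , λ x p∣x²+k+1 → ¬negSq (negativeSquare k x p∣x²+k+1)
    where
    k : Fin (h ℕ.+ h)
    k = proj₁ (Fin.¬∀⟶∃¬ (h ℕ.+ h) NegativeSquare negativeSquare? not-all-negative-squares)
    ¬negSq : ¬ NegativeSquare k
    ¬negSq = proj₂ (Fin.¬∀⟶∃¬ (h ℕ.+ h) NegativeSquare negativeSquare? not-all-negative-squares)

  anisotropic-residue : ∃ λ N → Anisotropic p N
  anisotropic-residue = N , anisotropic
    where
    N = proj₁ nonresidue
    anisotropic : Anisotropic p N
    anisotropic x y p∣x²+Ny² = decidable-stable (+ p ∣? y) λ p∤y →
      proj₂ nonresidue (x * inv p∤y) (∣ᶻ-resp
        (∣m∣n⇒∣m-n (∣m⇒∣m*n (inv p∤y * inv p∤y) p∣x²+Ny²)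
                   (∣n⇒∣m*n (+ N) (∣m⇒∣m*n (y * inv p∤y + 1ℤ) (proj₂ (inverse pr y p∤y)))))
        (rearrange x y (inv p∤y) (+ N)))
      where
      inv : p ∤ᶻ y → ℤ
      inv p∤y = proj₁ (inverse pr y p∤y)
      rearrange : ∀ x y i N → (x * x + N * (y * y)) * (i * i) - N * ((y * i - 1ℤ) * (y * i + 1ℤ)) ≡ x * i * (x * i) + N
      rearrange = solve-∀

  hensel-lift : ∀ j a u S → p ∤ᶻ a → p ∤ᶻ u → (p ℕ.^ suc j) ∣ᶻ a * (u * u) + S →
    ∃ λ u' → p ∤ᶻ u' × (p ℕ.^ suc (suc j)) ∣ᶻ a * (u' * u') + S
  hensel-lift j a u S p∤a p∤u (divides s eq) = u' , p∤u' , divides c (begin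
    a * (u' * u') + S                                  ≡⟨ expand a u t q S ⟩
    (a * (u * u) + S) + q * (+ 2 * a * u * t + a * (t * t) * q) ≡⟨ cong (_+ q * (+ 2 * a * u * t + a * (t * t) * q)) eq ⟩
    s * q + q * (+ 2 * a * u * t + a * (t * t) * q)    ≡⟨ collect s q a u t ⟩
    q * X                                              ≡⟨ cong (q *_) (_∣_.equality p∣X) ⟩
    q * (c * + p)                                      ≡⟨ regroup q c (+ p) ⟩
    c * (+ p * q)                                      ≡⟨ cong (c *_) (sym (pos-* p (p ℕ.^ suc j))) ⟩
    c * + (p ℕ.^ suc (suc j))                          ∎)
    where
    open ≡-Reasoning
    q = + (p ℕ.^ suc j)
    p∣q : p ∣ᶻ q
    p∣q = ∣ᶻ-resp (∣m⇒∣m*n (+ (p ℕ.^ j)) ∣-refl) (sym (pos-* p (p ℕ.^ j)))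
    2au = + 2 * a * u
    p∤2au : p ∤ᶻ 2au
    p∤2au = ∤∧∤⇒∤* pr (+ 2 * a) u (∤∧∤⇒∤* pr (+ 2) a p∤2 p∤a) p∤u
    i = proj₁ (inverse pr 2au p∤2au)
    -- Newton step: t ≡ - s / (2 a u) kills the linear term modulo p.
    t = - s * i
    u' = u + t * q
    p∤u' : p ∤ᶻ u'
    p∤u' p∣u' = p∤u (∣ᶻ-resp (∣m∣n⇒∣m-n p∣u' (∣n⇒∣m*n t p∣q)) (cancel u (t * q)))
      where cancel : ∀ a b → a + b - b ≡ a
            cancel = solve-∀
    X = s + 2au * t + a * (t * t) * q
    p∣X : p ∣ᶻ X
    p∣X = ∣ᶻ-resp (∣m∣n⇒∣m+n (∣n⇒∣m*n (- s) (proj₂ (inverse pr 2au p∤2au))) (∣n⇒∣m*n (a * (t * t)) p∣q))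
                  (rearrange s a u i q)
      where rearrange : ∀ s a u i q → - s * (+ 2 * a * u * i - 1ℤ) + a * ((- s * i) * (- s * i)) * q
                                     ≡ s + + 2 * a * u * (- s * i) + a * ((- s * i) * (- s * i)) * q
            rearrange = solve-∀
    c = _∣_.quotient p∣X
    expand : ∀ a u t q S → a * ((u + t * q) * (u + t * q)) + S ≡ (a * (u * u) + S) + q * (+ 2 * a * u * t + a * (t * t) * q)
    expand = solve-∀
    collect : ∀ s q a u t → s * q + q * (+ 2 * a * u * t + a * (t * t) * q) ≡ q * (s + + 2 * a * u * t + a * (t * t) * q)
    collect = solve-∀
    regroup : ∀ q c p → q * (c * p) ≡ c * (p * q)
    regroup = solve-∀


module LargePrime (p h : ℕ) (pr : Prime p) (p≡2h+1 : p ≡ ℕ.suc (h ℕ.+ h)) (7≤p : 7 ℕ.≤ p) where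

  open import Data.Nat as ℕ using (ℕ; zero; suc)
  import Data.Nat.Properties as ℕ
  open import Data.Integer hiding (NonZero; suc)
  open import Data.Integer.Properties
  open import Data.Integer.Divisibility.Signed
  open import Data.Integer.Tactic.RingSolver
  open import Data.Sum using ([_,_]′)
  open import Data.Product using (∃; ∃₂; _×_; _,_; proj₁; proj₂)
  open import Data.List using (List; []; _∷_; length)
  open import Data.List.Relation.Unary.All using (All; []; _∷_)
  open import Data.Empty using (⊥-elim)
  open import Relation.Binary.PropositionalEquality
  open import Relation.Nullary using (Dec; yes; no)
  open Divisibility
  open OddPrime p h pr p≡2h+1

  p∤3 : p ∤ᶻ + 3
  p∤3 = 0<∧<⇒∤ (ℕ.s≤s ℕ.z≤n) (ℕ.≤-trans (ℕ.s≤s (ℕ.s≤s (ℕ.s≤s (ℕ.s≤s ℕ.z≤n)))) 7≤p)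

  p∤5 : p ∤ᶻ + 5
  p∤5 = 0<∧<⇒∤ (ℕ.s≤s ℕ.z≤n) (ℕ.≤-trans (ℕ.s≤s (ℕ.s≤s (ℕ.s≤s (ℕ.s≤s (ℕ.s≤s (ℕ.s≤s ℕ.z≤n))))))
                                         7≤p)

  -- One of l = 1, 2 works, since otherwise p divides 4 (1 ± k) - (1 ± 4 k), i.e. 3 or 5.
  conic-parameter : ∀ k → ∃ λ l → p ∤ᶻ l × p ∤ᶻ 1ℤ + k * (l * l) × p ∤ᶻ 1ℤ - k * (l * l)
  conic-parameter k with + p ∣? (1ℤ + k * (1ℤ * 1ℤ)) | + p ∣? (1ℤ - k * (1ℤ * 1ℤ))
                       | + p ∣? (1ℤ + k * (+ 2 * + 2)) | + p ∣? (1ℤ - k * (+ 2 * + 2))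
  ... | no p∤1+k | no p∤1-k | _ | _ = 1ℤ , prime∤1 pr , p∤1+k , p∤1-k
  ... | yes _ | _ | no p∤1+4k | no p∤1-4k = + 2 , p∤2 , p∤1+4k , p∤1-4k
  ... | _ | yes _ | no p∤1+4k | no p∤1-4k = + 2 , p∤2 , p∤1+4k , p∤1-4k
  ... | yes p∣1+k | _ | yes p∣1+4k | _ =
    ⊥-elim (p∤3 (∣ᶻ-resp (∣m∣n⇒∣m-n (∣n⇒∣m*n (+ 4) p∣1+k) p∣1+4k) (eliminate k)))
    where eliminate : ∀ k → + 4 * (1ℤ + k * (1ℤ * 1ℤ)) - (1ℤ + k * (+ 2 * + 2)) ≡ + 3
          eliminate = solve-∀
  ... | yes p∣1+k | _ | _ | yes p∣1-4k =
    ⊥-elim (p∤5 (∣ᶻ-resp (∣m∣n⇒∣m+n (∣n⇒∣m*n (+ 4) p∣1+k) p∣1-4k) (eliminate k)))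
    where eliminate : ∀ k → + 4 * (1ℤ + k * (1ℤ * 1ℤ)) + (1ℤ - k * (+ 2 * + 2)) ≡ + 5
          eliminate = solve-∀
  ... | _ | yes p∣1-k | yes p∣1+4k | _ =
    ⊥-elim (p∤5 (∣ᶻ-resp (∣m∣n⇒∣m+n (∣n⇒∣m*n (+ 4) p∣1-k) p∣1+4k) (eliminate k)))
    where eliminate : ∀ k → + 4 * (1ℤ - k * (1ℤ * 1ℤ)) + (1ℤ + k * (+ 2 * + 2)) ≡ + 5
          eliminate = solve-∀
  ... | _ | yes p∣1-k | _ | yes p∣1-4k =
    ⊥-elim (p∤3 (∣ᶻ-resp (∣m∣n⇒∣m-n (∣n⇒∣m*n (+ 4) p∣1-k) p∣1-4k) (eliminate k)))
    where eliminate : ∀ k → + 4 * (1ℤ - k * (1ℤ * 1ℤ)) - (1ℤ - k * (+ 2 * + 2)) ≡ + 3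
          eliminate = solve-∀

  -- With k = b / a and a unit l from conic-parameter k, the point
  -- (X , Y) = ((1 - k l²) , 2 l) / (1 + k l²) lies on a X² + b Y² = a.
  unit-representation : ∀ a b u₀ → p ∤ᶻ a → p ∤ᶻ b → p ∤ᶻ u₀ →
    ∃₂ λ u v → p ∤ᶻ u × p ∤ᶻ v × p ∣ᶻ a * (u * u) + b * (v * v) - a * (u₀ * u₀)
  unit-representation a b u₀ p∤a p∤b p∤u₀ =
    u₀ * X , u₀ * Y , ∤∧∤⇒∤* pr u₀ X p∤u₀ p∤X , ∤∧∤⇒∤* pr u₀ Y p∤u₀ p∤Y ,
    ∣ᶻ-resp (∣n⇒∣m*n (u₀ * u₀) p∣aX²+bY²-a) (scale a b u₀ X Y)
    where
    ia = proj₁ (inverse pr a p∤a)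
    l = proj₁ (conic-parameter (b * ia))
    p∤l = proj₁ (proj₂ (conic-parameter (b * ia)))
    p∤D = proj₁ (proj₂ (proj₂ (conic-parameter (b * ia))))
    p∤1-kl² = proj₂ (proj₂ (proj₂ (conic-parameter (b * ia))))
    D = 1ℤ + b * ia * (l * l)
    i = proj₁ (inverse pr D p∤D)
    p∤i : p ∤ᶻ i
    p∤i = inverse-∤ pr D i (proj₂ (inverse pr D p∤D))
    X = (1ℤ - b * ia * (l * l)) * i
    Y = + 2 * l * i
    p∤X : p ∤ᶻ X
    p∤X = ∤∧∤⇒∤* pr _ i p∤1-kl² p∤i
    p∤Y : p ∤ᶻ Y
    p∤Y = ∤∧∤⇒∤* pr _ i (∤∧∤⇒∤* pr (+ 2) l p∤2 p∤l) p∤i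
    p∣aX²+bY²-a : p ∣ᶻ a * (X * X) + b * (Y * Y) - a
    p∣aX²+bY²-a = ∣ᶻ-resp
      (∣m∣n⇒∣m-n (∣n⇒∣m*n a (∣m⇒∣m*n (D * i + 1ℤ) (proj₂ (inverse pr D p∤D))))
                 (∣n⇒∣m*n (b * (Y * Y)) (proj₂ (inverse pr a p∤a))))
      (sym (conic a b ia l i))
      where
      conic : ∀ a b ia l i →
        a * ((1ℤ - b * ia * (l * l)) * i * ((1ℤ - b * ia * (l * l)) * i)) + b * (+ 2 * l * i * (+ 2 * l * i)) - a
        ≡ a * (((1ℤ + b * ia * (l * l)) * i - 1ℤ) * ((1ℤ + b * ia * (l * l)) * i + 1ℤ))
          - b * (+ 2 * l * i * (+ 2 * l * i)) * (a * ia - 1ℤ)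
      conic = solve-∀
    scale : ∀ a b u X Y → u * u * (a * (X * X) + b * (Y * Y) - a)
                          ≡ a * (u * X * (u * X)) + b * (u * Y * (u * Y)) - a * (u * u)
    scale = solve-∀

  private
    unit-solution₂ : ∀ a b T → p ∤ᶻ a → p ∤ᶻ b → p ∤ᶻ T → ∀ u v → u ℕ.≤ h → v ℕ.≤ h →
      p ∣ᶻ a * sq u + b * sq v + T → ∃₂ λ u v → p ∤ᶻ u × p ∤ᶻ v × p ∣ᶻ a * (u * u) + b * (v * v) + T
    unit-solution₂ a b T _ _ p∤T zero zero _ _ p∣ = ⊥-elim (p∤T (∣ᶻ-resp p∣ (vanish a b T)))
      where vanish : ∀ a b T → a * (0ℤ * 0ℤ) + b * (0ℤ * 0ℤ) + T ≡ T
            vanish = solve-∀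
    unit-solution₂ a b T p∤a p∤b _ zero (suc v) _ v<h p∣ =
      let v' , u' , p∤v' , p∤u' , p∣rep = unit-representation b a (+ suc v) p∤b p∤a (≤h⇒∤ (suc v) (λ ()) v<h)
      in u' , v' , p∤u' , p∤v' , ∣ᶻ-resp (∣m∣n⇒∣m+n p∣rep p∣) (combine a b T u' v' (+ suc v))
      where combine : ∀ a b T u' v' v → b * (v' * v') + a * (u' * u') - b * (v * v) + (a * (0ℤ * 0ℤ) + b * (v * v) + T)
                                        ≡ a * (u' * u') + b * (v' * v') + T
            combine = solve-∀
    unit-solution₂ a b T p∤a p∤b _ (suc u) zero u<h _ p∣ =
      let u' , v' , p∤u' , p∤v' , p∣rep = unit-representation a b (+ suc u) p∤a p∤b (≤h⇒∤ (suc u) (λ ()) u<h)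
      in u' , v' , p∤u' , p∤v' , ∣ᶻ-resp (∣m∣n⇒∣m+n p∣rep p∣) (combine a b T u' v' (+ suc u))
      where combine : ∀ a b T u' v' u → a * (u' * u') + b * (v' * v') - a * (u * u) + (a * (u * u) + b * (0ℤ * 0ℤ) + T)
                                        ≡ a * (u' * u') + b * (v' * v') + T
            combine = solve-∀
    unit-solution₂ a b T _ _ _ (suc u) (suc v) u<h v<h p∣ =
      + suc u , + suc v , ≤h⇒∤ (suc u) (λ ()) u<h , ≤h⇒∤ (suc v) (λ ()) v<h , p∣

  diagonal₂-unit-solvable : ∀ a b T → p ∤ᶻ a → p ∤ᶻ b → p ∤ᶻ T →
    ∃₂ λ u v → p ∤ᶻ u × p ∤ᶻ v × p ∣ᶻ a * (u * u) + b * (v * v) + T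
  diagonal₂-unit-solvable a b T p∤a p∤b p∤T =
    let u , v , u≤h , v≤h , p∣ = diagonal₂-solvable a b T p∤a p∤b
    in unit-solution₂ a b T p∤a p∤b p∤T u v u≤h v≤h p∣

  private
    -- If p ∣ e + c then e 2² + c ≡ 3 e is a unit.
    third-coordinate : ∀ e c → p ∤ᶻ e → Dec (p ∣ᶻ e * (1ℤ * 1ℤ) + c) →
      ∃ λ w → p ∤ᶻ w × p ∤ᶻ e * (w * w) + c
    third-coordinate e c p∤e (no p∤e+c) = 1ℤ , prime∤1 pr , p∤e+c
    third-coordinate e c p∤e (yes p∣e+c) = + 2 , p∤2 , λ p∣4e+c →
      [ p∤3 , p∤e ]′ (euclidsLemmaᶻ pr (+ 3) e (∣ᶻ-resp (∣m∣n⇒∣m-n p∣4e+c p∣e+c) (difference e c)))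
      where difference : ∀ e c → e * (+ 2 * + 2) + c - (e * (1ℤ * 1ℤ) + c) ≡ + 3 * e
            difference = solve-∀

  diagonal₃-unit-solvable : ∀ a b e c → p ∤ᶻ a → p ∤ᶻ b → p ∤ᶻ e →
    ∃ λ u → ∃ λ v → ∃ λ w → p ∤ᶻ u × p ∤ᶻ v × p ∤ᶻ w × p ∣ᶻ a * (u * u) + b * (v * v) + e * (w * w) + c
  diagonal₃-unit-solvable a b e c p∤a p∤b p∤e =
    let w , p∤w , p∤T = third-coordinate e c p∤e (+ p ∣? (e * (1ℤ * 1ℤ) + c))
        u , v , p∤u , p∤v , p∣ = diagonal₂-unit-solvable a b (e * (w * w) + c) p∤a p∤b p∤T
    in u , v , w , p∤u , p∤v , p∤w , ∣ᶻ-resp p∣ (sym (+-assoc (a * (u * u) + b * (v * v)) (e * (w * w)) c))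

  diagonal₃-unit-solvable-mod-power : ∀ j a b e c → p ∤ᶻ a → p ∤ᶻ b → p ∤ᶻ e →
    ∃ λ u → ∃ λ v → ∃ λ w → p ∤ᶻ u × p ∤ᶻ v × p ∤ᶻ w ×
      p ℕ.^ suc j ∣ᶻ a * (u * u) + b * (v * v) + e * (w * w) + c
  diagonal₃-unit-solvable-mod-power zero a b e c p∤a p∤b p∤e =
    let u , v , w , p∤u , p∤v , p∤w , p∣ = diagonal₃-unit-solvable a b e c p∤a p∤b p∤e
    in u , v , w , p∤u , p∤v , p∤w , subst (_∣ᶻ a * (u * u) + b * (v * v) + e * (w * w) + c) (sym (ℕ.*-identityʳ p)) p∣
  diagonal₃-unit-solvable-mod-power (suc j) a b e c p∤a p∤b p∤e =
    let u , v , w , p∤u , p∤v , p∤w , pʲ∣ = diagonal₃-unit-solvable-mod-power j a b e c p∤a p∤b p∤e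
        u' , p∤u' , pʲ⁺¹∣ = hensel-lift j a u (b * (v * v) + e * (w * w) + c) p∤a p∤u
                              (∣ᶻ-resp pʲ∣ (regroup a b e c u v w))
    in u' , v , w , p∤u' , p∤v , p∤w , ∣ᶻ-resp pʲ⁺¹∣ (sym (regroup a b e c u' v w))
    where
    regroup : ∀ a b e c u v w → a * (u * u) + b * (v * v) + e * (w * w) + c ≡ a * (u * u) + (b * (v * v) + e * (w * w) + c)
    regroup = solve-∀

  unitCount : List ℤ → ℕ
  unitCount []       = 0
  unitCount (c ∷ cs) with + p ∣? c
  ... | yes _ = unitCount cs
  ... | no  _ = suc (unitCount cs)

  unitCount-∤ : ∀ {c} cs → p ∤ᶻ c → unitCount (c ∷ cs) ≡ suc (unitCount cs)
  unitCount-∤ {c} cs p∤c with + p ∣? c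
  ... | yes p∣c = ⊥-elim (p∤c p∣c)
  ... | no  _   = refl

  unitCount-∣ : ∀ {c} cs → p ∣ᶻ c → unitCount (c ∷ cs) ≡ unitCount cs
  unitCount-∣ {c} cs p∣c with + p ∣? c
  ... | yes _   = refl
  ... | no  p∤c = ⊥-elim (p∤c p∣c)

  UnitSolution : ℕ → List ℤ → ℤ → Set
  UnitSolution M cs c = ∃ λ us → length us ≡ length cs × All (p ∤ᶻ_) us × M ∣ᶻ diagonal cs us + c

  module _ (j : ℕ) where

    private
      M = p ℕ.^ suc j

      ones : List ℤ → List ℤ
      ones []       = []
      ones (_ ∷ cs) = 1ℤ ∷ ones cs

      ones-units : ∀ cs → length (ones cs) ≡ length cs × All (p ∤ᶻ_) (ones cs)
      ones-units []       = refl , []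
      ones-units (_ ∷ cs) = cong suc (proj₁ (ones-units cs)) , prime∤1 pr ∷ proj₂ (ones-units cs)

      absorb : ∀ x cs c → UnitSolution M cs (c + x * (1ℤ * 1ℤ)) → UnitSolution M (x ∷ cs) c
      absorb x cs c (us , len , units , M∣) =
        1ℤ ∷ us , cong suc len , prime∤1 pr ∷ units , ∣ᶻ-resp M∣ (regroup x c (diagonal cs us))
        where regroup : ∀ x c s → s + (c + x * (1ℤ * 1ℤ)) ≡ x * (1ℤ * 1ℤ) + s + c
              regroup = solve-∀

      with-three-units : ∀ a b e cs c → p ∤ᶻ a → p ∤ᶻ b → p ∤ᶻ e →
        ∃ λ u → ∃ λ v → ∃ λ w → p ∤ᶻ u × p ∤ᶻ v × p ∤ᶻ w ×
          UnitSolution M cs (a * (u * u) + b * (v * v) + e * (w * w) + c)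
      with-three-units a b e cs c p∤a p∤b p∤e =
        let u , v , w , p∤u , p∤v , p∤w , M∣ =
              diagonal₃-unit-solvable-mod-power j a b e (diagonal cs (ones cs) + c) p∤a p∤b p∤e
        in u , v , w , p∤u , p∤v , p∤w , ones cs , proj₁ (ones-units cs) , proj₂ (ones-units cs) ,
           ∣ᶻ-resp M∣ (regroup a b e c (diagonal cs (ones cs)) u v w)
        where regroup : ∀ a b e c s u v w → a * (u * u) + b * (v * v) + e * (w * w) + (s + c)
                                            ≡ s + (a * (u * u) + b * (v * v) + e * (w * w) + c)
              regroup = solve-∀

      with-two-units : ∀ a b cs c → p ∤ᶻ a → p ∤ᶻ b → 1 ℕ.≤ unitCount cs →
        ∃ λ u → ∃ λ v → p ∤ᶻ u × p ∤ᶻ v × UnitSolution M cs (a * (u * u) + b * (v * v) + c)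
      with-two-units a b (x ∷ cs) c p∤a p∤b count with + p ∣? x
      ... | yes _ =
        let u , v , p∤u , p∤v , sol = with-two-units a b cs (c + x * (1ℤ * 1ℤ)) p∤a p∤b count
        in u , v , p∤u , p∤v , absorb x cs _ (subst (UnitSolution M cs) (sym (+-assoc (a * (u * u) + b * (v * v)) c _)) sol)
      ... | no p∤x =
        let u , v , w , p∤u , p∤v , p∤w , us , len , units , M∣ = with-three-units a b x cs c p∤a p∤b p∤x
        in u , v , p∤u , p∤v , w ∷ us , cong suc len , p∤w ∷ units , ∣ᶻ-resp M∣ (regroup a b x c u v w (diagonal cs us))
        where regroup : ∀ a b x c u v w s → s + (a * (u * u) + b * (v * v) + x * (w * w) + c)
                                            ≡ x * (w * w) + s + (a * (u * u) + b * (v * v) + c)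
              regroup = solve-∀

      with-one-unit : ∀ a cs c → p ∤ᶻ a → 2 ℕ.≤ unitCount cs →
        ∃ λ u → p ∤ᶻ u × UnitSolution M cs (a * (u * u) + c)
      with-one-unit a (x ∷ cs) c p∤a count with + p ∣? x
      ... | yes _ =
        let u , p∤u , sol = with-one-unit a cs (c + x * (1ℤ * 1ℤ)) p∤a count
        in u , p∤u , absorb x cs _ (subst (UnitSolution M cs) (sym (+-assoc (a * (u * u)) c _)) sol)
      with-one-unit a (x ∷ cs) c p∤a (ℕ.s≤s count) | no p∤x =
        let u , w , p∤u , p∤w , us , len , units , M∣ = with-two-units a x cs c p∤a p∤x count
        in u , p∤u , w ∷ us , cong suc len , p∤w ∷ units , ∣ᶻ-resp M∣ (regroup a x c u w (diagonal cs us))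
        where regroup : ∀ a x c u w s → s + (a * (u * u) + x * (w * w) + c) ≡ x * (w * w) + s + (a * (u * u) + c)
              regroup = solve-∀

    diagonal-unit-solvable : ∀ cs c → 3 ℕ.≤ unitCount cs → UnitSolution M cs c
    diagonal-unit-solvable (x ∷ cs) c count with + p ∣? x
    ... | yes _ = absorb x cs c (diagonal-unit-solvable cs (c + x * (1ℤ * 1ℤ)) count)
    diagonal-unit-solvable (x ∷ cs) c (ℕ.s≤s count) | no p∤x =
      let w , p∤w , us , len , units , M∣ = with-one-unit x cs c p∤x count
      in w ∷ us , cong suc len , p∤w ∷ units , ∣ᶻ-resp M∣ (regroup x c w (diagonal cs us))
      where regroup : ∀ x c w s → s + (x * (w * w) + c) ≡ x * (w * w) + s + c
            regroup = solve-∀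


module QuaternaryForm where

  open import Data.Nat as ℕ using (ℕ; NonZero)
  import Data.Nat.Properties as ℕ
  import Data.Nat.Divisibility as ℕ
  open import Data.Nat.Primality using (Prime; euclidsLemma; prime⇒nonZero; ¬prime[1])
  open import Data.Nat.Primality.Factorisation using (factorise)
  open import Data.Nat.ListAction using (product)
  open import Data.Nat.Coprimality using (coprime-divisor)
  open import Data.Integer hiding (NonZero)
  open import Data.Integer.Properties
  open import Data.Integer.Divisibility.Signed
  open import Data.Integer.Tactic.RingSolver
  open import Data.Integer.DivMod using (_%ℕ_)
  open import Data.List using (List; []; _∷_)
  open import Data.List.Relation.Unary.All as All using (All; []; _∷_)
  open import Data.List.Relation.Unary.Any using (here; there)
  open import Data.List.Membership.Propositional using (_∈_)
  open import Data.List.Membership.DecPropositional ℕ._≟_ using (_∈?_)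
  open import Data.Sum using (inj₁; inj₂; [_,_]′)
  open import Data.Product using (∃; ∃₂; _×_; _,_; proj₁; proj₂)
  open import Data.Empty using (⊥-elim)
  open import Function using (id)
  open import Relation.Binary.PropositionalEquality
  open import Relation.Nullary using (¬_; yes; no)
  open Divisibility

  quaternary : ℕ → ℕ → ℤ → ℤ → ℤ → ℤ → ℤ
  quaternary r R a b c d = a * a + + r * (b * b) + + R * (c * c) + + (r ℕ.* R) * (d * d)

  DividesAll : ℕ → ℤ → ℤ → ℤ → ℤ → Set
  DividesAll q a b c d = q ∣ᶻ a × q ∣ᶻ b × q ∣ᶻ c × q ∣ᶻ d

  LocallyAnisotropic : ℕ → ℕ → ℕ → Set
  LocallyAnisotropic r R q = q ℕ.∣ R × ¬ q ℕ.* q ℕ.∣ R × Anisotropic q r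

  private
    binary-local : ∀ {q r} → Prime q → Anisotropic q r → ∀ a b → q ∣ᶻ a * a + + r * (b * b) → q ∣ᶻ a × q ∣ᶻ b
    binary-local {r = r} pr aniso a b q∣ = q∣a , q∣b
      where
      q∣b : _ ∣ᶻ b
      q∣b = aniso a b q∣
      q∣a = [ id , id ]′ (euclidsLemmaᶻ pr a a (∣m+n∣n⇒∣m q∣ (∣n⇒∣m*n (+ r) (∣m⇒∣m*n b q∣b))))

    binary-square : ∀ {q} r a b → q ∣ᶻ a → q ∣ᶻ b → q ℕ.* q ∣ᶻ a * a + + r * (b * b)
    binary-square {q} r _ _ (divides a refl) (divides b refl) = divides (a * a + + r * (b * b))
      (trans (expand a b (+ r) (+ q)) (cong ((a * a + + r * (b * b)) *_) (sym (pos-* q q))))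
      where expand : ∀ a b r q → a * q * (a * q) + r * (b * q * (b * q)) ≡ (a * a + r * (b * b)) * (q * q)
            expand = solve-∀

    squarefree-∣* : ∀ {q R} X → Prime q → q ℕ.∣ R → ¬ q ℕ.* q ℕ.∣ R → q ℕ.* q ∣ᶻ + R * X → q ∣ᶻ X
    squarefree-∣* {q} X pr (ℕ.divides R' refl) q²∤R q²∣RX =
      [ (λ q∣R' → ⊥-elim (q²∤R (ℕ.*-monoˡ-∣ q (∣⇒∣ᵤ q∣R')))) , id ]′ (euclidsLemmaᶻ pr (+ R') X q∣R'X)
      where
      instance _ = prime⇒nonZero pr
      q∣R'X : q ∣ᶻ + R' * X
      q∣R'X = *-cancelˡ-∣ (+ q) (subst₂ _∣_ (pos-* q q)
        (trans (cong (_* X) (pos-* R' q)) (regroup (+ R') (+ q) X)) q²∣RX)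
        where regroup : ∀ a b x → a * b * x ≡ b * (a * x)
              regroup = solve-∀

  quaternary-local : ∀ {q r R} → Prime q → LocallyAnisotropic r R q → ∀ a b c d →
    q ℕ.* q ∣ᶻ quaternary r R a b c d → DividesAll q a b c d
  quaternary-local {q} {r} {R} pr (q∣R , q²∤R , aniso) a b c d q²∣Q = q∣a , q∣b , q∣c , q∣d
    where
    Y = c * c + + r * (d * d)
    split : quaternary r R a b c d ≡ (a * a + + r * (b * b)) + + R * Y
    split = trans (cong (λ z → a * a + + r * (b * b) + + R * (c * c) + z * (d * d)) (pos-* r R))
                  (regroup a b c d (+ r) (+ R))
      where regroup : ∀ a b c d r R → a * a + r * (b * b) + R * (c * c) + r * R * (d * d)
                                      ≡ (a * a + r * (b * b)) + R * (c * c + r * (d * d))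
            regroup = solve-∀
    q²∣Q' : q ℕ.* q ∣ᶻ (a * a + + r * (b * b)) + + R * Y
    q²∣Q' = ∣ᶻ-resp q²∣Q split
    q∣R*Y : q ∣ᶻ + R * Y
    q∣R*Y = ∣m⇒∣m*n Y (∣ᵤ⇒∣ {+ q} {+ R} q∣R)
    q∣Q' : q ∣ᶻ (a * a + + r * (b * b)) + + R * Y
    q∣Q' = ∣-trans (∣ᵤ⇒∣ {+ q} {+ (q ℕ.* q)} (ℕ.∣m⇒∣m*n q ℕ.∣-refl)) q²∣Q'
    q∣a×q∣b = binary-local {r = r} pr aniso a b (∣m+n∣n⇒∣m q∣Q' q∣R*Y)
    q∣a = proj₁ q∣a×q∣b
    q∣b = proj₂ q∣a×q∣b
    q∣Y : q ∣ᶻ Y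
    q∣Y = squarefree-∣* Y pr q∣R q²∤R (∣m+n∣m⇒∣n q²∣Q' (binary-square r a b q∣a q∣b))
    q∣c×q∣d = binary-local {r = r} pr aniso c d q∣Y
    q∣c = proj₁ q∣c×q∣d
    q∣d = proj₂ q∣c×q∣d

  quaternary-descent : ∀ {r R} qs → All Prime qs → All (LocallyAnisotropic r R) qs → ∀ a b c d →
    product qs ℕ.* product qs ∣ᶻ quaternary r R a b c d → DividesAll (product qs) a b c d
  quaternary-descent [] _ _ a b c d _ = 1∣ a , 1∣ b , 1∣ c , 1∣ d
    where 1∣ : ∀ z → 1 ∣ᶻ z
          1∣ z = divides z (sym (*-identityʳ z))
  quaternary-descent {r} {R} (q ∷ qs) (pr ∷ prs) (loc ∷ locs) a b c d P²∣Q =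
    lift a b c d P²∣Q (quaternary-local {r = r} {R = R} pr loc a b c d (∣-trans (∣ᵤ⇒∣ {+ (q ℕ.* q)} q²∣P²) P²∣Q))
    where
    instance _ = prime⇒nonZero pr
    P = product qs
    q²∣P² : q ℕ.* q ℕ.∣ (q ℕ.* P) ℕ.* (q ℕ.* P)
    q²∣P² = ℕ.*-pres-∣ (ℕ.m∣m*n {q} P) (ℕ.m∣m*n {q} P)
    scale : ∀ a b c d → quaternary r R (a * + q) (b * + q) (c * + q) (d * + q) ≡ + q * (+ q * quaternary r R a b c d)
    scale a b c d = regroup a b c d (+ r) (+ R) (+ (r ℕ.* R)) (+ q)
      where regroup : ∀ a b c d r R rR q →
              a * q * (a * q) + r * (b * q * (b * q)) + R * (c * q * (c * q)) + rR * (d * q * (d * q))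
              ≡ q * (q * (a * a + r * (b * b) + R * (c * c) + rR * (d * d)))
            regroup = solve-∀
    qP² : + ((q ℕ.* P) ℕ.* (q ℕ.* P)) ≡ + q * (+ q * + (P ℕ.* P))
    qP² = trans (pos-* (q ℕ.* P) (q ℕ.* P)) (trans (cong₂ _*_ (pos-* q P) (pos-* q P))
            (trans (regroup (+ q) (+ P)) (cong (λ z → + q * (+ q * z)) (sym (pos-* P P)))))
      where regroup : ∀ q P → q * P * (q * P) ≡ q * (q * (P * P))
            regroup = solve-∀
    times-q : ∀ {x} → P ∣ᶻ x → q ℕ.* P ∣ᶻ x * + q
    times-q {x} P∣x = subst (_∣ x * + q) (trans (sym (pos-* P q)) (cong +_ (ℕ.*-comm P q))) (*-monoˡ-∣ (+ q) P∣x)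
    lift : ∀ a b c d → (q ℕ.* P) ℕ.* (q ℕ.* P) ∣ᶻ quaternary r R a b c d → DividesAll q a b c d →
           DividesAll (q ℕ.* P) a b c d
    lift _ _ _ _ P²∣Q (divides a refl , divides b refl , divides c refl , divides d refl) =
      times-q P∣a , times-q P∣b , times-q P∣c , times-q P∣d
      where
      P∣ = quaternary-descent {r} {R} qs prs locs a b c d
             (*-cancelˡ-∣ (+ q) (*-cancelˡ-∣ (+ q) (subst₂ _∣_ qP² (scale a b c d) P²∣Q)))
      P∣a = proj₁ P∣
      P∣b = proj₁ (proj₂ P∣)
      P∣c = proj₁ (proj₂ (proj₂ P∣))
      P∣d = proj₂ (proj₂ (proj₂ P∣))

  linear-congruence : ∀ {q M} → Prime q → ¬ q ℕ.∣ M → ∀ r N → ∃ λ t → q ∣ᶻ + (r ℕ.+ M ℕ.* t) - + N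
  linear-congruence {q} {M} pr q∤M r N = t , ∣ᶻ-resp
    (∣m∣n⇒∣m+n (∣n⇒∣m*n (- + M) (∣z-z%ℕ t₀ q)) (∣n⇒∣m*n (+ N - + r) (proj₂ (inverseℕ pr q∤M))))
    (trans (rearrange (+ N) (+ r) (+ M) i (+ t)) (cong (_- + N) (sym (trans (pos-+ r (M ℕ.* t)) (cong (λ z → + r + z) (pos-* M t))))))
    where
    instance _ = prime⇒nonZero pr
    i = proj₁ (inverseℕ pr q∤M)
    t₀ = (+ N - + r) * i
    t = t₀ %ℕ q
    rearrange : ∀ N r M i t → - M * ((N - r) * i - t) + (N - r) * (M * i - 1ℤ) ≡ (r + M * t) - N
    rearrange = solve-∀

  private
    Adapted : ℕ → ℕ → List ℕ → Set
    Adapted r R qs = All (LocallyAnisotropic r R) qs × (∀ ℓ → Prime ℓ → ℓ ℕ.∣ R → ℓ ∈ qs)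

    adapted-coefficients : ∀ qs → All Prime qs → ¬ 2 ℕ.∣ product qs → ∃₂ λ r R → Adapted r R qs
    adapted-coefficients [] _ _ = 0 , 1 , [] , λ ℓ pℓ ℓ∣1 → ⊥-elim (¬prime[1] (subst Prime (ℕ.∣1⇒≡1 ℓ∣1) pℓ))
    adapted-coefficients (q ∷ qs) (pr ∷ prs) 2∤qP
      with adapted-coefficients qs prs (λ 2∣P → 2∤qP (ℕ.∣n⇒∣m*n q 2∣P)) | q ∈? qs
    ... | r , R , locs , R-primes | yes q∈qs =
      r , R , All.lookup locs q∈qs ∷ locs , λ ℓ pℓ ℓ∣R → there (R-primes ℓ pℓ ℓ∣R)
    ... | r' , R' , locs , R'-primes | no q∉qs =
      r , q ℕ.* R' ,
      local-q ∷ All.tabulate (λ ℓ∈qs → local-ℓ (All.lookup prs ℓ∈qs) (All.lookup locs ℓ∈qs) ℓ∈qs) ,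
      qR'-primes
      where
      q∤R' : ¬ q ℕ.∣ R'
      q∤R' q∣R' = q∉qs (R'-primes q pr q∣R')
      h = proj₁ (odd⇒≡2h+1 q (λ 2∣q → 2∤qP (ℕ.∣m⇒∣m*n (product qs) 2∣q)))
      q≡2h+1 = proj₂ (odd⇒≡2h+1 q (λ 2∣q → 2∤qP (ℕ.∣m⇒∣m*n (product qs) 2∣q)))
      N = proj₁ (OddPrime.anisotropic-residue q h pr q≡2h+1)
      t = proj₁ (linear-congruence pr q∤R' r' N)
      r = r' ℕ.+ R' ℕ.* t
      local-q : LocallyAnisotropic r (q ℕ.* R') q
      local-q = ℕ.m∣m*n R' , (λ q²∣qR' → q∤R' (ℕ.*-cancelˡ-∣ q ⦃ prime⇒nonZero pr ⦄ q²∣qR')) ,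
                Anisotropic-resp {q} {r} {N} (proj₂ (linear-congruence pr q∤R' r' N))
                  (proj₂ (OddPrime.anisotropic-residue q h pr q≡2h+1))
      local-ℓ : ∀ {ℓ} → Prime ℓ → LocallyAnisotropic r' R' ℓ → ℓ ∈ qs → LocallyAnisotropic r (q ℕ.* R') ℓ
      local-ℓ {ℓ} pℓ (ℓ∣R' , ℓ²∤R' , aniso) ℓ∈qs =
        ℕ.∣n⇒∣m*n q ℓ∣R' ,
        (λ ℓ²∣qR' → ℓ²∤R' (coprime-divisor (prime∤⇒coprime pr q∤ℓ²) ℓ²∣qR')) ,
        Anisotropic-resp {ℓ} {r} {r'}
          (∣ᶻ-resp (∣m⇒∣m*n (+ t) (∣ᵤ⇒∣ {+ ℓ} {+ R'} ℓ∣R')) (shift r' (R' ℕ.* t) (pos-* R' t))) aniso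
        where
        q∤ℓ : ¬ q ℕ.∣ ℓ
        q∤ℓ q∣ℓ = q∉qs (subst (_∈ qs) (sym (prime∣prime⇒≡ pr pℓ q∣ℓ)) ℓ∈qs)
        q∤ℓ² : ¬ q ℕ.∣ ℓ ℕ.* ℓ
        q∤ℓ² q∣ℓ² = [ q∤ℓ , q∤ℓ ]′ (euclidsLemma ℓ ℓ pr q∣ℓ²)
        shift : ∀ a b → + b ≡ + R' * + t → + R' * + t ≡ + (a ℕ.+ b) - + a
        shift a b b≡ = trans (sym b≡) (trans (cancel (+ a) (+ b)) (cong (_- + a) (sym (pos-+ a b))))
          where cancel : ∀ a b → b ≡ a + b - a
                cancel = solve-∀
      qR'-primes : ∀ ℓ → Prime ℓ → ℓ ℕ.∣ q ℕ.* R' → ℓ ∈ q ∷ qs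
      qR'-primes ℓ pℓ ℓ∣qR' with euclidsLemma q R' pℓ ℓ∣qR'
      ... | inj₁ ℓ∣q  = here (prime∣prime⇒≡ pℓ pr ℓ∣q)
      ... | inj₂ ℓ∣R' = there (R'-primes ℓ pℓ ℓ∣R')

  -- R is the product of the distinct prime factors q of m and - r is a non-square modulo
  -- each of them (which needs q odd); q² ∣ Q then forces q to divide all four variables.
  anisotropic-quaternary : ∀ m .{{_ : NonZero m}} → ¬ 2 ℕ.∣ m →
    ∃₂ λ r R → ∀ a b c d → m ℕ.* m ∣ᶻ quaternary r R a b c d → DividesAll m a b c d
  anisotropic-quaternary m 2∤m with factorise m
  ... | record { factors = qs ; isFactorisation = refl ; factorsPrime = prs } =
    let r , R , locs , _ = adapted-coefficients qs prs 2∤m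
    in r , R , quaternary-descent {r} {R} qs prs locs


module Weights (n : ℕ) .{{_ : NonZero n}} where

  import Data.Nat.Properties as ℕ
  import Data.Nat.Divisibility as ℕ
  open import Data.Nat.DivMod using (_%_; m%n<n; %-distribˡ-*)
  open import Data.Integer hiding (NonZero; _%_)
  open import Data.Integer.Properties
  open import Data.Integer.Divisibility.Signed
  open import Data.Integer.Tactic.RingSolver
  open import Data.Fin using (Fin; toℕ; fromℕ<)
  open import Data.Fin.Properties using (toℕ-fromℕ<)
  open import Data.List using (List; []; _∷_; map)
  open import Data.List.Relation.Unary.All using (All; []; _∷_)
  open import Data.List.Relation.Binary.Pointwise using (Pointwise; []; _∷_)
  open import Data.Product using (∃; _×_; _,_)
  open import Relation.Binary.PropositionalEquality
  open import Relation.Nullary using (¬_)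
  open Divisibility

  toℤ : Fin n → ℤ
  toℤ x = + toℕ x

  residue : ℕ → Fin n
  residue v = fromℕ< (m%n<n v n)

  squareResidue : ℕ → Fin n
  squareResidue w = residue (w ℕ.* w)

  ∣v%n-v : ∀ v → n ∣ᶻ + (v % n) - + v
  ∣v%n-v v = ∣ᶻ-resp (∣m⇒∣-m (∣z-z%ℕ (+ v) n)) (negate (+ v) (+ (v % n)))
    where negate : ∀ a b → - (a - b) ≡ b - a
          negate = solve-∀

  ∣residue-v : ∀ v → n ∣ᶻ toℤ (residue v) - + v
  ∣residue-v v = subst (λ r → n ∣ᶻ + r - + v) (sym (toℕ-fromℕ< (m%n<n v n))) (∣v%n-v v)

  squareResidue-InS* : ∀ w → ¬ n ℕ.∣ w ℕ.* w → InS* n (squareResidue w)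
  squareResidue-InS* w n∤w² =
    (λ r≡0 → n∤w² (ℕ.m%n≡0⇒n∣m _ n (trans (sym (toℕ-fromℕ< (m%n<n (w ℕ.* w) n))) r≡0))) ,
    residue w ,
    (begin
      (toℕ (residue w) ℕ.* toℕ (residue w)) % n ≡⟨ cong (λ r → (r ℕ.* r) % n) (toℕ-fromℕ< (m%n<n w n)) ⟩
      ((w % n) ℕ.* (w % n)) % n               ≡⟨ %-distribˡ-* w w n ⟨
      (w ℕ.* w) % n                           ≡⟨ toℕ-fromℕ< (m%n<n (w ℕ.* w) n) ⟨
      toℕ (squareResidue w)                   ∎)
    where open ≡-Reasoning

  SquareWeights : List (Fin n) → List ℕ → Set
  SquareWeights = Pointwise (λ a w → (w ℕ.* w) % n ≡ toℕ a)

  square-roots : ∀ {as} → AllS* n as → ∃ λ ws → SquareWeights as ws × All (λ w → ¬ n ℕ.∣ w ℕ.* w) ws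
  square-roots []                            = [] , [] , []
  square-roots ((a≢0 , x , x²≡a) ∷ weights) =
    let ws , roots , nonzero = square-roots weights
    in toℕ x ∷ ws , x²≡a ∷ roots , (λ n∣x² → a≢0 (trans (sym x²≡a) (ℕ.n∣m⇒m%n≡0 _ n n∣x²))) ∷ nonzero

  wsum-≡-diagonal : ∀ {as ws} → SquareWeights as ws → ∀ xs →
    n ∣ᶻ + wsum as xs - diagonal (map toℤ xs) (map +_ ws)
  wsum-≡-diagonal []                []       = divides 0ℤ refl
  wsum-≡-diagonal []                (_ ∷ _)  = divides 0ℤ refl
  wsum-≡-diagonal (_ ∷ _)           []       = divides 0ℤ refl
  wsum-≡-diagonal {a ∷ as} {w ∷ ws} (w²≡a ∷ roots) (x ∷ xs) = ∣ᶻ-resp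
    (∣m∣n⇒∣m+n (∣m⇒∣m*n (toℤ x) (subst (λ r → n ∣ᶻ + r - + (w ℕ.* w)) w²≡a (∣v%n-v (w ℕ.* w))))
               (wsum-≡-diagonal roots xs))
    (trans (rearrange (+ toℕ a) (+ (w ℕ.* w)) (toℤ x) (+ wsum as xs) (diagonal (map toℤ xs) (map +_ ws)))
           (cong₂ (λ s t → s - (toℤ x * t + diagonal (map toℤ xs) (map +_ ws)))
                  (trans (cong (_+ + wsum as xs) (sym (pos-* (toℕ a) (toℕ x)))) (sym (pos-+ _ (wsum as xs))))
                  (pos-* w w)))
    where
    rearrange : ∀ a W x s d → (a - W) * x + (s - d) ≡ a * x + s - (x * W + d)
    rearrange = solve-∀

  squareResidue-weights : ∀ ws → SquareWeights (map squareResidue ws) ws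
  squareResidue-weights []       = []
  squareResidue-weights (w ∷ ws) = sym (toℕ-fromℕ< (m%n<n (w ℕ.* w) n)) ∷ squareResidue-weights ws

  squareResidues-AllS* : ∀ {ws} → All (λ w → ¬ n ℕ.∣ w ℕ.* w) ws → AllS* n (map squareResidue ws)
  squareResidues-AllS* []                 = []
  squareResidues-AllS* {w ∷ _} (n∤w² ∷ nonzero) = squareResidue-InS* w n∤w² ∷ squareResidues-AllS* nonzero


module LowerBound (n m : ℕ) .{{_ : NonZero n}} (n≡m² : n ≡ m ℕ.* m) (2∤n : ¬ 2 ℕ.∣ n) where

  import Data.Nat.Properties as ℕ
  open import Data.Integer hiding (NonZero)
  open import Data.Integer.Properties
  open import Data.Integer.Divisibility.Signed
  open import Data.Integer.Tactic.RingSolver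
  open import Data.Fin using (Fin)
  open import Data.List using (List; []; _∷_; map; length; take)
  open import Data.List.Properties using (length-take)
  open import Data.List.Relation.Unary.All using (All; []; _∷_)
  open import Data.List.Relation.Unary.Any using (Any; here; there)
  open import Data.List.Relation.Binary.Pointwise using (Pointwise-length)
  open import Data.List.Relation.Binary.Sublist.Propositional using (_⊆_; []; _∷_; _∷ʳ_; ⊆-refl; ⊆-trans)
  open import Data.List.Relation.Binary.Sublist.Propositional.Properties using (++⁺ˡ; ++⁺ʳ; take-⊆)
  open import Data.Product using (_,_; proj₁; proj₂)
  open import Data.Empty using (⊥-elim)
  open import Relation.Binary.PropositionalEquality
  open Divisibility
  open QuaternaryForm
  open Weights n

  private
    instance
      m-nonZero : NonZero m
      m-nonZero = ℕ.≢-nonZero λ m≡0 → ℕ.≢-nonZero⁻¹ n (trans n≡m² (cong (λ z → z ℕ.* z) m≡0))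

    2∤m : ¬ 2 ℕ.∣ m
    2∤m 2∣m = 2∤n (subst (2 ℕ.∣_) (sym n≡m²) (ℕ.∣m⇒∣m*n m 2∣m))

    r = proj₁ (anisotropic-quaternary m 2∤m)
    R = proj₁ (proj₂ (anisotropic-quaternary m 2∤m))

  coefficients : List ℕ
  coefficients = 1 ∷ r ∷ R ∷ r ℕ.* R ∷ []

  sequence : List (Fin n)
  sequence = map residue coefficients

  private
    pad : ∀ {ys xs : List (Fin n)} → ys ⊆ xs → List ℕ → List ℕ
    pad []            _        = []
    pad (_ ∷ʳ σ)      ws       = 0 ∷ pad σ ws
    pad (refl ∷ σ)    []       = 0 ∷ pad σ []
    pad (refl ∷ σ)    (w ∷ ws) = w ∷ pad σ ws

    length-pad : ∀ {ys xs} (σ : ys ⊆ xs) ws → length (pad σ ws) ≡ length xs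
    length-pad []         _        = refl
    length-pad (_ ∷ʳ σ)   ws       = cong ℕ.suc (length-pad σ ws)
    length-pad (refl ∷ σ) []       = cong ℕ.suc (length-pad σ [])
    length-pad (refl ∷ σ) (w ∷ ws) = cong ℕ.suc (length-pad σ ws)

    diagonal-pad : ∀ {ys xs} (σ : ys ⊆ xs) ws → length ws ≡ length ys →
      diagonal (map toℤ ys) (map +_ ws) ≡ diagonal (map toℤ xs) (map +_ (pad σ ws))
    diagonal-pad []           []       _   = refl
    diagonal-pad (x ∷ʳ σ)     ws       len =
      trans (diagonal-pad σ ws len) (sym (trans (cong (_+ _) (*-zeroʳ (toℤ x))) (+-identityˡ _)))
    diagonal-pad {x ∷ _} (refl ∷ σ) (w ∷ ws) len =
      cong (λ s → toℤ x * (+ w * + w) + s) (diagonal-pad σ ws (ℕ.suc-injective len))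

    any-pad : ∀ {P : ℕ → Set} {ys xs} (σ : ys ⊆ xs) {ws} → length ws ≡ length ys → Any P ws → Any P (pad σ ws)
    any-pad []         {[]}    _   ()
    any-pad (_ ∷ʳ σ)           len p∈ws         = there (any-pad σ len p∈ws)
    any-pad (refl ∷ σ)         _   (here p)     = here p
    any-pad (refl ∷ σ)         len (there p∈ws) = there (any-pad σ (ℕ.suc-injective len) p∈ws)

    diagonal-residues : ∀ vs us → n ∣ᶻ diagonal (map toℤ (map residue vs)) us - diagonal (map +_ vs) us
    diagonal-residues []       _        = divides 0ℤ refl
    diagonal-residues (_ ∷ _)  []       = divides 0ℤ refl
    diagonal-residues (v ∷ vs) (u ∷ us) = ∣ᶻ-resp
      (∣m∣n⇒∣m+n (∣m⇒∣m*n (u * u) (∣residue-v v)) (diagonal-residues vs us))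
      (rearrange (toℤ (residue v)) (+ v) (u * u) _ _)
      where rearrange : ∀ a b U s t → (a - b) * U + (s - t) ≡ a * U + s - (b * U + t)
            rearrange = solve-∀

    quaternary-≡-diagonal : ∀ a b c d → diagonal (map +_ coefficients) (map +_ (a ∷ b ∷ c ∷ d ∷ []))
                                        ≡ quaternary r R (+ a) (+ b) (+ c) (+ d)
    quaternary-≡-diagonal a b c d = regroup (+ a) (+ b) (+ c) (+ d) (+ r) (+ R) (+ (r ℕ.* R))
      where regroup : ∀ a b c d r R rR → 1ℤ * (a * a) + (r * (b * b) + (R * (c * c) + (rR * (d * d) + 0ℤ)))
                                        ≡ a * a + r * (b * b) + R * (c * c) + rR * (d * d)
            regroup = solve-∀

    -- Anisotropy makes every weight divisible by m, so its square vanishes modulo n = m².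
    weights-vanish : ∀ ws → length ws ≡ 4 → n ∣ᶻ diagonal (map toℤ sequence) (map +_ ws) →
                     ¬ Any (λ w → ¬ n ℕ.∣ w ℕ.* w) ws
    weights-vanish (a ∷ b ∷ c ∷ d ∷ []) refl n∣ nonzero = vanish nonzero
      where
      m²∣Q : m ℕ.* m ∣ᶻ quaternary r R (+ a) (+ b) (+ c) (+ d)
      m²∣Q = subst (_∣ᶻ quaternary r R (+ a) (+ b) (+ c) (+ d)) n≡m²
               (∣ᶻ-resp (∣m∣n⇒∣m-n n∣ (diagonal-residues coefficients (map +_ (a ∷ b ∷ c ∷ d ∷ []))))
               (trans (cancel (diagonal (map toℤ sequence) (map +_ (a ∷ b ∷ c ∷ d ∷ []))) _) (quaternary-≡-diagonal a b c d)))
        where cancel : ∀ s t → s - (s - t) ≡ t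
              cancel = solve-∀
      m∣ = proj₂ (proj₂ (anisotropic-quaternary m 2∤m)) (+ a) (+ b) (+ c) (+ d) m²∣Q
      n∣w² : ∀ {w} → m ∣ᶻ + w → n ℕ.∣ w ℕ.* w
      n∣w² m∣w = subst (ℕ._∣ _) (sym n≡m²) (ℕ.*-pres-∣ (∣⇒∣ᵤ m∣w) (∣⇒∣ᵤ m∣w))
      vanish : ¬ Any (λ w → ¬ n ℕ.∣ w ℕ.* w) (a ∷ b ∷ c ∷ d ∷ [])
      vanish (here n∤a²)                         = n∤a² (n∣w² (proj₁ m∣))
      vanish (there (here n∤b²))                 = n∤b² (n∣w² (proj₁ (proj₂ m∣)))
      vanish (there (there (here n∤c²)))         = n∤c² (n∣w² (proj₁ (proj₂ (proj₂ m∣))))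
      vanish (there (there (there (here n∤d²)))) = n∤d² (n∣w² (proj₂ (proj₂ (proj₂ m∣))))

  no-weighted-zero-sum : ∀ {ys} → ys ⊆ sequence → ¬ WeightedZeroSum n ys
  no-weighted-zero-sum {ys} σ (ys≢[] , as , len , weights , wsum≡0) =
    weights-vanish (pad σ ws) (length-pad σ ws)
      (subst (n ∣ᶻ_) (diagonal-pad σ ws len')
        (∣ᶻ-resp (∣m∣n⇒∣m-n (∣ᵤ⇒∣ {+ n} {+ wsum as ys} (ℕ.m%n≡0⇒n∣m _ n wsum≡0)) (wsum-≡-diagonal roots ys))
                  (cancel (+ wsum as ys) (diagonal (map toℤ ys) (map +_ ws)))))
      (any-pad σ len' (first-nonzero ws ys≢[] len' nonzero))
    where
    ws = proj₁ (square-roots weights)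
    roots = proj₁ (proj₂ (square-roots weights))
    nonzero = proj₂ (proj₂ (square-roots weights))
    len' : length ws ≡ length ys
    len' = trans (sym (Pointwise-length roots)) len
    cancel : ∀ s t → s - (s - t) ≡ t
    cancel = solve-∀
    first-nonzero : ∀ {P : ℕ → Set} ws → ys ≢ [] → length ws ≡ length ys → All P ws → Any P ws
    first-nonzero [] ys≢[] len _ = ⊥-elim (ys≢[] (lengthZero ys (sym len)))
      where lengthZero : ∀ ys → length ys ≡ 0 → ys ≡ []
            lengthZero [] _ = refl
    first-nonzero (_ ∷ _) _ _ (p ∷ _) = here p

  lower-bound : ∀ k → k ℕ.< 5 → ¬ Prop-C n k
  lower-bound k k<5 zero-sums =
    let pre , ys , suf , eq , wzs = zero-sums (take k sequence) (trans (length-take k sequence) (ℕ.m≤n⇒m⊓n≡m (ℕ.≤-pred k<5)))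
    in no-weighted-zero-sum (⊆-trans (subst (ys ⊆_) (sym eq) (++⁺ˡ pre (++⁺ʳ suf ⊆-refl))) (take-⊆ k sequence)) wzs


module UpperBound (n p k : ℕ) .{{_ : NonZero n}} (pr : Prime p) (7≤p : 7 ℕ.≤ p)
                  (n≡p⁴k² : n ≡ p ℕ.^ 4 ℕ.* (k ℕ.* k)) where

  import Data.Nat.Properties as ℕ
  import Data.Nat.Divisibility as ℕ
  open import Data.Nat.Primality using (¬prime[1]; prime[2]; prime⇒nonZero)
  import Data.Nat.Tactic.RingSolver as ℕ-Solver
  open import Data.Integer hiding (NonZero)
  open import Data.Integer.Properties
  open import Data.Integer.Divisibility.Signed
  open import Data.Integer.Tactic.RingSolver
  open import Data.Fin using (Fin; toℕ)
  open import Data.List using (List; []; _∷_; _++_; map; length)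
  open import Data.List.Properties using (length-map; ++-identityʳ)
  open import Data.List.Relation.Unary.All using (All; []; _∷_)
  open import Data.List.Relation.Unary.All.Properties using (¬Any⇒All¬)
  open import Data.List.Relation.Unary.Any using (Any; any?)
  open import Data.List.Membership.Propositional using (find)
  open import Data.List.Membership.Propositional.Properties using (∈-∃++)
  open import Data.Sum using (_⊎_; inj₁; inj₂)
  open import Data.Product using (_×_; _,_; proj₁; proj₂)
  open import Data.Empty using (⊥-elim)
  open import Function using (_∘_)
  open import Relation.Binary.PropositionalEquality
  open import Relation.Nullary using (¬_; Dec; yes; no)
  open Divisibility
  open Weights n

  private
    2∤p : ¬ 2 ℕ.∣ p
    2∤p 2∣p = 7≰2 (subst (7 ℕ.≤_) (sym (prime∣prime⇒≡ prime[2] pr 2∣p)) 7≤p)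
      where 7≰2 : ¬ 7 ℕ.≤ 2
            7≰2 (ℕ.s≤s (ℕ.s≤s ()))

    h = proj₁ (odd⇒≡2h+1 p 2∤p)
    p≡2h+1 = proj₂ (odd⇒≡2h+1 p 2∤p)

    instance
      p-nonZero : NonZero p
      p-nonZero = prime⇒nonZero pr
      k-nonZero : NonZero k
      k-nonZero = ℕ.≢-nonZero λ k≡0 → ℕ.≢-nonZero⁻¹ n
        (trans n≡p⁴k² (trans (cong (λ z → p ℕ.^ 4 ℕ.* (z ℕ.* z)) k≡0) (ℕ.*-zeroʳ (p ℕ.^ 4))))
      k²-nonZero : NonZero (k ℕ.* k)
      k²-nonZero = ℕ.m*n≢0 k k

  open LargePrime p h pr p≡2h+1 7≤p

  private
    square-abs : ∀ u → + (∣ u ∣ ℕ.* ∣ u ∣) ≡ u * u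
    square-abs (+ n)    = pos-* n n
    square-abs -[1+ n ] = refl

    p⁴≡p²p² : p ℕ.^ 4 ≡ (p ℕ.* p) ℕ.* (p ℕ.* p)
    p⁴≡p²p² = regroup p
      where regroup : ∀ p → p ℕ.* (p ℕ.* (p ℕ.* (p ℕ.* 1))) ≡ (p ℕ.* p) ℕ.* (p ℕ.* p)
            regroup = ℕ-Solver.solve-∀

  -- The weight of a term x is (k T x u)², where T x² x = pᵉ C x; a unit zero of Σ C x u²
  -- modulo p ^ (j + 1) then gives a zero-sum modulo n = p⁴ k².
  module Scaled (e j : ℕ) (pᵉpʲ≡p⁴ : p ℕ.^ e ℕ.* p ℕ.^ ℕ.suc j ≡ p ℕ.^ 4)
                (T : Fin n → ℕ) (C : Fin n → ℤ)
                (T²x≡pᵉC : ∀ x → + (T x ℕ.* T x ℕ.* toℕ x) ≡ + (p ℕ.^ e) * C x)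
                (p⁴∤T²u² : ∀ x u → ¬ p ℕ.∣ u → ¬ p ℕ.^ 4 ℕ.∣ (T x ℕ.* T x) ℕ.* (u ℕ.* u)) where

    private
      root : Fin n → ℤ → ℕ
      root x u = k ℕ.* T x ℕ.* ∣ u ∣

      roots : List (Fin n) → List ℤ → List ℕ
      roots (x ∷ xs) (u ∷ us) = root x u ∷ roots xs us
      roots _        _        = []

      length-roots : ∀ xs us → length us ≡ length xs → length (roots xs us) ≡ length xs
      length-roots []       []       _   = refl
      length-roots (x ∷ xs) (u ∷ us) len = cong ℕ.suc (length-roots xs us (ℕ.suc-injective len))

      roots-nonzero : ∀ xs us → length us ≡ length xs → All (p ∤ᶻ_) us → All (λ w → ¬ n ℕ.∣ w ℕ.* w) (roots xs us)
      roots-nonzero []       []       _   []             = []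
      roots-nonzero (x ∷ xs) (u ∷ us) len (p∤u ∷ units) =
        (λ n∣root² → p⁴∤T²u² x ∣ u ∣ (p∤u ∘ ∣ᵤ⇒∣) (ℕ.*-cancelʳ-∣ (k ℕ.* k)
           (subst₂ ℕ._∣_ n≡p⁴k² (regroup k (T x) ∣ u ∣) n∣root²)))
        ∷ roots-nonzero xs us (ℕ.suc-injective len) units
        where regroup : ∀ k T a → k ℕ.* T ℕ.* a ℕ.* (k ℕ.* T ℕ.* a) ≡ T ℕ.* T ℕ.* (a ℕ.* a) ℕ.* (k ℕ.* k)
              regroup = ℕ-Solver.solve-∀

      diagonal-roots : ∀ xs us → length us ≡ length xs →
        diagonal (map toℤ xs) (map +_ (roots xs us)) ≡ + k * + k * (+ (p ℕ.^ e) * diagonal (map C xs) us)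
      diagonal-roots []       []       _   = sym (trans (cong (+ k * + k *_) (*-zeroʳ (+ (p ℕ.^ e)))) (*-zeroʳ (+ k * + k)))
      diagonal-roots (x ∷ xs) (u ∷ us) len = begin
        toℤ x * (+ root x u * + root x u) + diagonal (map toℤ xs) (map +_ (roots xs us))
          ≡⟨ cong₂ (λ r d → toℤ x * (r * r) + d) root-cast (diagonal-roots xs us (ℕ.suc-injective len)) ⟩
        toℤ x * (+ k * + T x * + ∣ u ∣ * (+ k * + T x * + ∣ u ∣)) + K * (P * D)
          ≡⟨ regroup (toℤ x) (+ k) (+ T x) (+ ∣ u ∣) (P * D) ⟩
        + k * + k * (+ T x * + T x * toℤ x * (+ ∣ u ∣ * + ∣ u ∣) + P * D)
          ≡⟨ cong₂ (λ s a → K * (s * a + P * D)) T²x-cast (trans (sym (pos-* ∣ u ∣ ∣ u ∣)) (square-abs u)) ⟩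
        K * (P * C x * (u * u) + P * D)
          ≡⟨ factor K P (C x) (u * u) D ⟩
        K * (P * (C x * (u * u) + D)) ∎
        where
        open ≡-Reasoning
        K = + k * + k
        P = + (p ℕ.^ e)
        D = diagonal (map C xs) us
        root-cast : + root x u ≡ + k * + T x * + ∣ u ∣
        root-cast = trans (pos-* (k ℕ.* T x) ∣ u ∣) (cong (_* + ∣ u ∣) (pos-* k (T x)))
        T²x-cast : + T x * + T x * toℤ x ≡ P * C x
        T²x-cast = trans (trans (cong (_* toℤ x) (sym (pos-* (T x) (T x)))) (sym (pos-* (T x ℕ.* T x) (toℕ x)))) (T²x≡pᵉC x)
        regroup : ∀ x k T a PD → x * (k * T * a * (k * T * a)) + k * k * PD ≡ k * k * (T * T * x * (a * a) + PD)
        regroup = solve-∀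
        factor : ∀ K P c U D → K * (P * c * U + P * D) ≡ K * (P * (c * U + D))
        factor = solve-∀

    scaled-zero-sum : ∀ xs → xs ≢ [] → 3 ℕ.≤ unitCount (map C xs) → HasConsecutiveWZS n xs
    scaled-zero-sum xs xs≢[] count =
      [] , xs , [] , sym (++-identityʳ xs) , xs≢[] , map squareResidue ws ,
      trans (length-map squareResidue ws) (length-roots xs us len) ,
      squareResidues-AllS* (roots-nonzero xs us len units) ,
      ℕ.n∣m⇒m%n≡0 _ n (∣⇒∣ᵤ (∣ᶻ-resp (∣m∣n⇒∣m+n (wsum-≡-diagonal (squareResidue-weights ws) xs) n∣diagonal)
                                     (cancel (+ wsum (map squareResidue ws) xs) (diagonal (map toℤ xs) (map +_ ws)))))
      where
      solution = diagonal-unit-solvable j (map C xs) 0ℤ count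
      us = proj₁ solution
      len : length us ≡ length xs
      len = trans (proj₁ (proj₂ solution)) (length-map C xs)
      units = proj₁ (proj₂ (proj₂ solution))
      ws = roots xs us
      D = diagonal (map C xs) us
      s = _∣_.quotient (proj₂ (proj₂ (proj₂ solution)))
      n∣diagonal : n ∣ᶻ diagonal (map toℤ xs) (map +_ ws)
      n∣diagonal = divides s (begin
        diagonal (map toℤ xs) (map +_ ws)           ≡⟨ diagonal-roots xs us len ⟩
        + k * + k * (+ (p ℕ.^ e) * D)              ≡⟨ cong (λ z → + k * + k * (+ (p ℕ.^ e) * z))
                                                       (trans (sym (+-identityʳ D)) (_∣_.equality (proj₂ (proj₂ (proj₂ solution))))) ⟩
        + k * + k * (+ (p ℕ.^ e) * (s * + (p ℕ.^ ℕ.suc j))) ≡⟨ regroup (+ k) (+ (p ℕ.^ e)) s (+ (p ℕ.^ ℕ.suc j)) ⟩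
        s * (+ (p ℕ.^ e) * + (p ℕ.^ ℕ.suc j) * (+ k * + k)) ≡⟨ cong (s *_) n-cast ⟩
        s * + n                                    ∎)
        where
        open ≡-Reasoning
        regroup : ∀ k P s Q → k * k * (P * (s * Q)) ≡ s * (P * Q * (k * k))
        regroup = solve-∀
        n-cast : + (p ℕ.^ e) * + (p ℕ.^ ℕ.suc j) * (+ k * + k) ≡ + n
        n-cast = trans (cong₂ _*_ (sym (pos-* (p ℕ.^ e) (p ℕ.^ ℕ.suc j))) (sym (pos-* k k)))
                   (trans (sym (pos-* (p ℕ.^ e ℕ.* p ℕ.^ ℕ.suc j) (k ℕ.* k)))
                     (trans (cong (λ z → + (z ℕ.* (k ℕ.* k))) pᵉpʲ≡p⁴) (cong +_ (sym n≡p⁴k²))))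
      cancel : ∀ w d → w - d + d ≡ w
      cancel = solve-∀

  private
    p⁴∤p²u² : ∀ u → ¬ p ℕ.∣ u → ¬ p ℕ.^ 4 ℕ.∣ (p ℕ.* p) ℕ.* (u ℕ.* u)
    p⁴∤p²u² u p∤u p⁴∣p²u² = p∤u (p∣m²⇒p∣m {m = u} pr (ℕ.∣-trans (ℕ.m∣m*n p)
      (ℕ.*-cancelˡ-∣ (p ℕ.* p) ⦃ ℕ.m*n≢0 p p ⦄ (subst (ℕ._∣ (p ℕ.* p) ℕ.* (u ℕ.* u)) p⁴≡p²p² p⁴∣p²u²))))

    p⁴∤u² : ∀ u → ¬ p ℕ.∣ u → ¬ p ℕ.^ 4 ℕ.∣ (1 ℕ.* 1) ℕ.* (u ℕ.* u)
    p⁴∤u² u p∤u p⁴∣u² = p∤u (p∣m²⇒p∣m {m = u} pr (ℕ.∣-trans (ℕ.m∣m*n (p ℕ.^ 3))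
      (subst (p ℕ.^ 4 ℕ.∣_) (ℕ.*-identityˡ (u ℕ.* u)) p⁴∣u²)))

    p²p²≡p⁴ : ∀ p → p ℕ.* (p ℕ.* 1) ℕ.* (p ℕ.* (p ℕ.* 1)) ≡ p ℕ.* (p ℕ.* (p ℕ.* (p ℕ.* 1)))
    p²p²≡p⁴ = ℕ-Solver.solve-∀

    pp³≡p⁴ : ∀ p → p ℕ.* 1 ℕ.* (p ℕ.* (p ℕ.* (p ℕ.* 1))) ≡ p ℕ.* (p ℕ.* (p ℕ.* (p ℕ.* 1)))
    pp³≡p⁴ = ℕ-Solver.solve-∀

    p²x≡p²·x : ∀ x → + (p ℕ.* p ℕ.* toℕ x) ≡ + (p ℕ.^ 2) * toℤ x
    p²x≡p²·x x = trans (cong (λ z → + (p ℕ.* z ℕ.* toℕ x)) (sym (ℕ.*-identityʳ p))) (pos-* (p ℕ.^ 2) (toℕ x))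

    T₁ : Fin n → ℕ
    T₁ x with p ℕ.∣? toℕ x
    ... | yes _ = 1
    ... | no  _ = p

    C₁ : Fin n → ℤ
    C₁ x with p ℕ.∣? toℕ x
    ... | yes p∣x = + ℕ.quotient p∣x
    ... | no  _   = + (p ℕ.* toℕ x)

    T₁²x≡pC₁ : ∀ x → + (T₁ x ℕ.* T₁ x ℕ.* toℕ x) ≡ + (p ℕ.^ 1) * C₁ x
    T₁²x≡pC₁ x with p ℕ.∣? toℕ x
    ... | yes (ℕ.divides q x≡qp) = trans (cong +_ (trans (ℕ.+-identityʳ (toℕ x))
                                     (trans x≡qp (trans (ℕ.*-comm q p) (cong (ℕ._* q) (sym (ℕ.*-identityʳ p)))))))
                                     (pos-* (p ℕ.* 1) q)
    ... | no  _ = trans (cong +_ (regroup p (toℕ x))) (pos-* (p ℕ.* 1) (p ℕ.* toℕ x))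
      where regroup : ∀ p x → p ℕ.* p ℕ.* x ≡ p ℕ.* 1 ℕ.* (p ℕ.* x)
            regroup = ℕ-Solver.solve-∀

    p⁴∤T₁²u² : ∀ x u → ¬ p ℕ.∣ u → ¬ p ℕ.^ 4 ℕ.∣ (T₁ x ℕ.* T₁ x) ℕ.* (u ℕ.* u)
    p⁴∤T₁²u² x u p∤u with p ℕ.∣? toℕ x
    ... | yes _ = p⁴∤u² u p∤u
    ... | no  _ = p⁴∤p²u² u p∤u

    exactly-one-unit : ∀ x → ¬ p ℕ.* p ℕ.∣ toℕ x →
      (p ∤ᶻ toℤ x × p ∣ᶻ C₁ x) ⊎ (p ∣ᶻ toℤ x × p ∤ᶻ C₁ x)
    exactly-one-unit x p²∤x with p ℕ.∣? toℕ x
    ... | yes (ℕ.divides q x≡qp) = inj₂ (∣ᵤ⇒∣ (ℕ.divides q x≡qp) ,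
            λ p∣q → p²∤x (subst (p ℕ.* p ℕ.∣_) (sym x≡qp) (ℕ.*-monoˡ-∣ p (∣⇒∣ᵤ p∣q))))
    ... | no  p∤x = inj₁ ((λ p∣x → p∤x (∣⇒∣ᵤ p∣x)) , ∣ᵤ⇒∣ (ℕ.m∣m*n (toℕ x)))

    unitCount-split : ∀ xs → All (λ x → ¬ p ℕ.* p ℕ.∣ toℕ x) xs →
      unitCount (map toℤ xs) ℕ.+ unitCount (map C₁ xs) ≡ length xs
    unitCount-split []       []             = refl
    unitCount-split (x ∷ xs) (p²∤x ∷ rest) with exactly-one-unit x p²∤x
    ... | inj₁ (p∤x , p∣C₁x) = trans (cong₂ ℕ._+_ (unitCount-∤ (map toℤ xs) p∤x) (unitCount-∣ (map C₁ xs) p∣C₁x))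
                                     (cong ℕ.suc (unitCount-split xs rest))
    ... | inj₂ (p∣x , p∤C₁x) = trans (cong₂ ℕ._+_ (unitCount-∣ (map toℤ xs) p∣x) (unitCount-∤ (map C₁ xs) p∤C₁x))
                                     (trans (ℕ.+-suc (unitCount (map toℤ xs)) _) (cong ℕ.suc (unitCount-split xs rest)))

    three-of-five : ∀ a b → a ℕ.+ b ≡ 5 → ¬ 3 ℕ.≤ a → 3 ℕ.≤ b
    three-of-five 0 _ refl _ = ℕ.s≤s (ℕ.s≤s (ℕ.s≤s ℕ.z≤n))
    three-of-five 1 _ refl _ = ℕ.s≤s (ℕ.s≤s (ℕ.s≤s ℕ.z≤n))
    three-of-five 2 _ refl _ = ℕ.s≤s (ℕ.s≤s (ℕ.s≤s ℕ.z≤n))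
    three-of-five (ℕ.suc (ℕ.suc (ℕ.suc _))) _ _ 3≰a = ⊥-elim (3≰a (ℕ.s≤s (ℕ.s≤s (ℕ.s≤s ℕ.z≤n))))

    single-term : ∀ xs pre x suf → xs ≡ pre ++ (x ∷ []) ++ suf → p ℕ.* p ℕ.∣ toℕ x → HasConsecutiveWZS n xs
    single-term xs pre x suf eq (ℕ.divides c x≡cp²) =
      pre , x ∷ [] , suf , eq , (λ ()) , squareResidue w ∷ [] , refl , squareResidue-InS* w n∤w² ∷ [] ,
      ℕ.n∣m⇒m%n≡0 _ n (∣⇒∣ᵤ (∣ᶻ-resp (∣m∣n⇒∣m+n (wsum-≡-diagonal (squareResidue-weights (w ∷ [])) (x ∷ [])) n∣xw²)
                                     (cancel (+ wsum (squareResidue w ∷ []) (x ∷ [])) (diagonal (map toℤ (x ∷ [])) (map +_ (w ∷ []))))))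
      where
      w = k ℕ.* p
      n∤w² : ¬ n ℕ.∣ w ℕ.* w
      n∤w² n∣w² = p²≢1 (ℕ.∣1⇒≡1 (ℕ.*-cancelˡ-∣ (p ℕ.* p) ⦃ ℕ.m*n≢0 p p ⦄ p⁴∣p²))
        where
        regroup : ∀ k p → k ℕ.* p ℕ.* (k ℕ.* p) ≡ p ℕ.* p ℕ.* (k ℕ.* k)
        regroup = ℕ-Solver.solve-∀
        p⁴∣p² : (p ℕ.* p) ℕ.* (p ℕ.* p) ℕ.∣ (p ℕ.* p) ℕ.* 1
        p⁴∣p² = subst₂ ℕ._∣_ p⁴≡p²p² (sym (ℕ.*-identityʳ (p ℕ.* p)))
                  (ℕ.*-cancelʳ-∣ (k ℕ.* k) (subst₂ ℕ._∣_ n≡p⁴k² (regroup k p) n∣w²))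
        p²≢1 : p ℕ.* p ≢ 1
        p²≢1 p²≡1 = ¬prime[1] (subst Prime (ℕ.m*n≡1⇒n≡1 p p p²≡1) pr)
      n∣xw² : n ∣ᶻ diagonal (map toℤ (x ∷ [])) (map +_ (w ∷ []))
      n∣xw² = divides (+ c) (begin
        toℤ x * (+ w * + w) + 0ℤ  ≡⟨ +-identityʳ _ ⟩
        toℤ x * (+ w * + w)       ≡⟨ cong (toℤ x *_) (pos-* w w) ⟨
        toℤ x * + (w ℕ.* w)       ≡⟨ pos-* (toℕ x) (w ℕ.* w) ⟨
        + (toℕ x ℕ.* (w ℕ.* w))   ≡⟨ cong +_ xw²≡cn ⟩
        + (c ℕ.* n)               ≡⟨ pos-* c n ⟩
        + c * + n                 ∎)
        where
        open ≡-Reasoning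
        regroup : ∀ c k p → c ℕ.* (p ℕ.* p) ℕ.* (k ℕ.* p ℕ.* (k ℕ.* p))
                            ≡ c ℕ.* ((p ℕ.* p) ℕ.* (p ℕ.* p) ℕ.* (k ℕ.* k))
        regroup = ℕ-Solver.solve-∀
        xw²≡cn : toℕ x ℕ.* (w ℕ.* w) ≡ c ℕ.* n
        xw²≡cn = trans (cong (ℕ._* (w ℕ.* w)) x≡cp²) (trans (regroup c k p)
                   (cong (c ℕ.*_) (trans (cong (ℕ._* (k ℕ.* k)) (sym p⁴≡p²p²)) (sym n≡p⁴k²))))
      cancel : ∀ w d → w - d + d ≡ w
      cancel = solve-∀

  module ByUnits = Scaled 2 1 (p²p²≡p⁴ p) (λ _ → p) toℤ p²x≡p²·x (λ _ → p⁴∤p²u²)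
  module ByMultiplesOfP = Scaled 1 2 (pp³≡p⁴ p) T₁ C₁ T₁²x≡pC₁ p⁴∤T₁²u²

  upper-bound : Prop-C n 5
  upper-bound xs len = decide (any? (λ x → p ℕ.* p ℕ.∣? toℕ x) xs)
    where
    xs≢[] : xs ≢ []
    xs≢[] refl = ℕ.0≢1+n len
    decide : Dec (Any (λ x → p ℕ.* p ℕ.∣ toℕ x) xs) → HasConsecutiveWZS n xs
    decide (yes some-p²∣x) =
      let x , x∈xs , p²∣x = find some-p²∣x
          pre , suf , eq = ∈-∃++ x∈xs
      in single-term xs pre x suf eq p²∣x
    decide (no no-p²∣x) with 3 ℕ.≤? unitCount (map toℤ xs)
    ... | yes 3≤units = ByUnits.scaled-zero-sum xs xs≢[] 3≤units
    ... | no  3≰units = ByMultiplesOfP.scaled-zero-sum xs xs≢[]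
          (three-of-five _ _ (trans (unitCount-split xs (¬Any⇒All¬ xs no-p²∣x)) len) 3≰units)


open import Data.Nat using (ℕ; _*_; _^_; _≤_; NonZero; s≤s; z≤n)
open import Data.Nat.Divisibility using (_∣_; divides)
open import Data.Nat.Primality using (Prime)
import Data.Nat.Tactic.RingSolver as ℕ-Solver
open import Data.Product using (∃-syntax; _×_; _,_)
open import Relation.Binary.PropositionalEquality
open import Relation.Nullary using (¬_)
open Divisibility using (p⁴∣m²⇒p²∣m)

corollary8 : (n : ℕ) .{{_ : NonZero n}} → ¬ (2 ∣ n) → (∃[ m ] (n ≡ m * m)) →
    (∃[ p ] (Prime p × 7 ≤ p × (p ^ 4) ∣ n)) → IsCS* n 5
corollary8 n 2∤n (m , n≡m²) (p , pr , 7≤p , p⁴∣n)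
  with divides k refl ← p⁴∣m²⇒p²∣m {m = m} pr (subst (p ^ 4 ∣_) n≡m² p⁴∣n) =
  s≤s z≤n ,
  UpperBound.upper-bound n p k pr 7≤p (trans n≡m² (regroup k p)) ,
  λ c _ → LowerBound.lower-bound n m n≡m² 2∤n c
  where
  regroup : ∀ k p → k * (p * p) * (k * (p * p)) ≡ p * (p * (p * (p * 1))) * (k * k)
  regroup = ℕ-Solver.solve-∀
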